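{- Let $d$ and $n$ be positive integers, $Q=\{0,\dots,n-1\}$, $R=\{0,\dots,d-1\}$. Let $\mathcal{T}$ be the set of $d$-ary trees whose node labels are exactly $0,\dots,n-1$ and whose leaf labels are exactly $n,\dots,dn$ (each used once), and let $\mathcal{S}$ be the set of permutations of $\{0,\dots,dn-1\}$. Then the maps $P:\mathcal{T}\to\mathcal{S}$ and $T:\mathcal{S}\to\mathcal{T}$ defined below are well defined and mutually inverse: $P(T(\pi))=\pi$ for all $\pi\in\mathcal{S}$ and $T(P(t))=t$ for all $t\in\mathcal{T}$. In particular they are bijections. Definition of $P$: for $t\in\mathcal{T}$ and $k\in\{0,\dots,dn-1\}$, let $\sigma_k(t)$ be the proper subtree of $t$ that is the $r$th child of the node labeled $q$, where $q=\lfloor k/d\rfloor$ and $r=k-dq$. Then $P(t)$ is the permutation $\pi$ of $\{0,\dots,dn-1\}$ such that $\sigma_{\pi(0)}(t)\prec\sigma_{\pi(1)}(t)\prec\cdots\prec\sigma_{\pi(dn-1)}(t)$. Definition of $T$: for $\pi\in\mathcal{S}$ and $q\in Q$, let $\iota(q)=1+\max\{\pi^{ -1}(dq+r): r\in R\}$. For $i=0,1,\dots,dn$ define recursively $\tau_i=\phi_q(\tau_{\pi^{ -1}(dq+0)},\dots,\tau_{\pi^{ -1}(dq+d-1)})$ if $i=\iota(q)$ for some $q\in Q$, and otherwise $\tau_i$ is the leaf labeled $n+i-\#\{q\in Q:\iota(q)<i\}$. Then $T(\pi)=\tau_{dn}$.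
   Context: A $d$-ary tree is a rooted tree in which every (nonterminal) node has exactly $d$ ordered children ($0$th through $(d-1)$th) and leaves have no children. For $q\in Q$, $\phi_q(u_0,\dots,u_{d-1})$ denotes the tree whose root is a node labeled $q$ with $r$th child subtree $u_r$; a leaf with label $p$ is a one-vertex tree. Define $\mathrm{maxleaf}$ and $\mathrm{height}$ recursively: for a leaf labeled $p$, $\mathrm{maxleaf}=p$ and $\mathrm{height}=0$; for $\phi_q(u_0,\dots,u_{d-1})$, $\mathrm{maxleaf}=\max_r \mathrm{maxleaf}(u_r)$ and $\mathrm{height}=1+\max_r\mathrm{height}(u_r)$. For trees $u,v$, $u\prec v$ holds iff $\mathrm{maxleaf}(u)<\mathrm{maxleaf}(v)$, or $\mathrm{maxleaf}(u)=\mathrm{maxleaf}(v)$ and $\mathrm{height}(u)<\mathrm{height}(v)$. -}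

module Defs where

open import Data.Nat using (ℕ; zero; suc; _+_; _*_; _∸_; _⊔_; _<_; _<?_; NonZero)
open import Data.Nat.Properties using (*-comm)
open import Data.Nat.DivMod using (_/_; _mod_)
open import Data.Fin using (Fin; toℕ; combine; cast)
open import Data.Fin.Permutation using (Permutation′; _⟨$⟩ʳ_; _⟨$⟩ˡ_)
open import Data.Vec using (Vec; []; _∷_; lookup; tabulate)
open import Data.List using (List; []; _∷_; _++_; [_]; applyUpTo; upTo; length; filter; allFin)
open import Data.List.Relation.Binary.Permutation.Propositional using (_↭_)
open import Data.Maybe using (Maybe; just; nothing)
open import Data.Product using (_×_; ∃₂; _,_)
open import Data.Sum using (_⊎_)
open import Relation.Binary.PropositionalEquality using (_≡_)
open import Relation.Nullary using (yes; no)

data Tree (d : ℕ) : Set where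
  leaf : ℕ → Tree d
  node : ℕ → Vec (Tree d) d → Tree d      -- node q us = φ_q(u_0,…,u_{d-1})

module _ {d : ℕ} where

  mutual
    maxleaf : Tree d → ℕ
    maxleaf (leaf p)    = p
    maxleaf (node q us) = maxleafs us

    maxleafs : ∀ {m} → Vec (Tree d) m → ℕ
    maxleafs []       = 0
    maxleafs (u ∷ us) = maxleaf u ⊔ maxleafs us

  mutual
    height : Tree d → ℕ
    height (leaf p)    = 0
    height (node q us) = suc (heights us)

    heights : ∀ {m} → Vec (Tree d) m → ℕ
    heights []       = 0
    heights (u ∷ us) = height u ⊔ heights us

  _≺_ : Tree d → Tree d → Set
  u ≺ v = maxleaf u < maxleaf v ⊎ (maxleaf u ≡ maxleaf v × height u < height v)

  mutual
    nodeLabels : Tree d → List ℕ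
    nodeLabels (leaf p)    = []
    nodeLabels (node q us) = q ∷ nodeLabelss us

    nodeLabelss : ∀ {m} → Vec (Tree d) m → List ℕ
    nodeLabelss []       = []
    nodeLabelss (u ∷ us) = nodeLabels u ++ nodeLabelss us

  mutual
    leafLabels : Tree d → List ℕ
    leafLabels (leaf p)    = [ p ]
    leafLabels (node q us) = leafLabelss us

    leafLabelss : ∀ {m} → Vec (Tree d) m → List ℕ
    leafLabelss []       = []
    leafLabelss (u ∷ us) = leafLabels u ++ leafLabelss us

  mutual
    childrenOf : ℕ → Tree d → Maybe (Vec (Tree d) d)
    childrenOf q (leaf p) = nothing
    childrenOf q (node q′ us) with q Data.Nat.≟ q′
    ... | yes _ = just us
    ... | no  _ = childrenOfs q us

    childrenOfs : ∀ {m} → ℕ → Vec (Tree d) m → Maybe (Vec (Tree d) d)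
    childrenOfs q []       = nothing
    childrenOfs q (u ∷ us) with childrenOf q u
    ... | just cs = just cs
    ... | nothing = childrenOfs q us

-- [a, b) as a list: a, a+1, …, b-1
interval : ℕ → ℕ → List ℕ
interval a b = applyUpTo (a +_) (b ∸ a)

InT : (d n : ℕ) → Tree d → Set
InT d n t = (nodeLabels t ↭ upTo n) × (leafLabels t ↭ interval n (suc (d * n)))

σ : (d : ℕ) .{{_ : NonZero d}} → Tree d → ℕ → Maybe (Tree d)
σ d t k with childrenOf (k / d) t
... | just cs = just (lookup cs (k mod d))
... | nothing = nothing

SubLt : (d : ℕ) .{{_ : NonZero d}} → Tree d → ℕ → ℕ → Set
SubLt d t k l = ∃₂ λ u v → σ d t k ≡ just u × σ d t l ≡ just v × u ≺ v

-- "P(t) = π": σ_{π(0)}(t) ≺ σ_{π(1)}(t) ≺ ⋯ ≺ σ_{π(dn-1)}(t)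
IsP : (d n : ℕ) .{{_ : NonZero d}} → Tree d → Permutation′ (d * n) → Set
IsP d n t π = ∀ (i j : Fin (d * n)) → toℕ j ≡ suc (toℕ i) →
              SubLt d t (toℕ (π ⟨$⟩ʳ i)) (toℕ (π ⟨$⟩ʳ j))

module TMap (d n : ℕ) (π : Permutation′ (d * n)) where

  idx : Fin n → Fin d → Fin (d * n)
  idx q r = cast (*-comm n d) (combine q r)

  πinv : Fin n → Fin d → ℕ
  πinv q r = toℕ (π ⟨$⟩ˡ idx q r)

  maxVec : ∀ {m} → Vec ℕ m → ℕ
  maxVec []       = 0
  maxVec (x ∷ xs) = x ⊔ maxVec xs

  ι : Fin n → ℕ
  ι q = suc (maxVec (tabulate (πinv q)))

  -- some q with ι(q) = i, if any (there is at most one)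
  findQ : ℕ → List (Fin n) → Maybe (Fin n)
  findQ i []       = nothing
  findQ i (q ∷ qs) with ι q Data.Nat.≟ i
  ... | yes _ = just q
  ... | no  _ = findQ i qs

  countBelow : ℕ → ℕ
  countBelow i = length (filter (λ q → ι q <? i) (allFin n))

  -- j-th element of the list of already constructed trees τ_0,…,τ_{i-1}.
  -- The default is never used: the recursion only asks for
  -- τ_{π⁻¹(dq+r)} with π⁻¹(dq+r) < ι(q) = i.
  nth : List (Tree d) → ℕ → Tree d
  nth []       j       = leaf 0
  nth (u ∷ us) zero    = u
  nth (u ∷ us) (suc j) = nth us j

  -- τ_i, given prev = [τ_0, …, τ_{i-1}]
  step : ℕ → List (Tree d) → Tree d
  step i prev with findQ i (allFin n)
  ... | just q  = node (toℕ q) (tabulate λ r → nth prev (πinv q r))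
  ... | nothing = leaf (n + i ∸ countBelow i)

  taus : ℕ → List (Tree d)
  taus zero    = []
  taus (suc i) = taus i ++ [ step i (taus i) ]

  τ : ℕ → Tree d
  τ i = step i (taus i)

T : (d n : ℕ) → Permutation′ (d * n) → Tree d
T d n π = TMap.τ d n π (d * n)

{-# OPTIONS --safe #-}
module Submission where

-- T reads π as the order in which the d n proper subtrees of the
-- result are built: τ_j, j = π⁻¹(d q + r), becomes the r-th child of node q,
-- and node q is assembled at step ι(q), right after its last child. Following
-- the unique parent of every index shows that τ_0, …, τ_{dn} are exactly the
-- subtrees of T(π) and that all labels are distinct. Leaves receive the labels
-- n, n+1, … in order of construction, so 1 + maxleaf(τ_j) is the label of the
-- next leaf; hence a new leaf has a larger maximal leaf than its predecessor,
-- and a new node has the same maximal leaf as its last child τ_j but a larger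
-- height. Thus τ_0 ≺ τ_1 ≺ ⋯ and P(T(π)) = π.
--
-- Conversely, in a tree with distinct labels two ≺-incomparable subtrees share
-- their maximal leaf and their height and therefore coincide, so the subtrees
-- of t ∈ 𝒯 form a ≺-chain v_0 ≺ ⋯ ≺ v_{dn} = t, which gives existence and
-- uniqueness of P(t). Induction on i then shows τ_i = v_i: the children of a
-- node v_i come before it, and its child carrying the maximal leaf is v_{i-1},
-- because anything strictly between them in ≺ would have to lie inside that
-- child; so i = ι(q). A leaf v_i carries the least leaf label not used before.

open import Defs
open import Data.Nat using (ℕ; NonZero)
open import Data.Nat using (_*_)
open import Data.Fin using (Fin)
open import Data.Fin.Permutation using (Permutation′; _⟨$⟩ʳ_)
open import Data.Product using (_×_; ∃)
open import Relation.Binary.PropositionalEquality using (_≡_)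

open import Data.Empty using (⊥-elim)
open import Data.Fin as F using (toℕ; fromℕ<; combine; cast; remQuot)
import Data.Fin.Properties as FinP
open import Data.Fin.Permutation using (permutation; _⟨$⟩ˡ_; inverseˡ; inverseʳ)
open import Data.List using (List; []; _∷_; _++_; [_]; length; filter; allFin)
open import Data.List.Properties using (filter-all; length-++; filter-notAll; filter-none; length-tabulate)
open import Data.List.Membership.Propositional using (_∈_; _∉_; lose)
open import Data.List.Membership.Propositional.Properties
  using (∈-applyUpTo⁺; ∈-applyUpTo⁻; ∈-upTo⁺; ∈-upTo⁻; ∈-++⁺ˡ; ∈-++⁺ʳ; ∈-++⁻; ∈-allFin)
open import Data.List.Membership.Propositional.Properties.WithK using (unique∧set⇒bag)
open import Data.List.Relation.Binary.BagAndSetEquality using (∼bag⇒↭)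
open import Data.List.Relation.Binary.Disjoint.Propositional using (Disjoint)
open import Data.List.Relation.Binary.Permutation.Propositional using (_↭_; ↭-sym; ↭⇒↭ₛ)
open import Data.List.Relation.Binary.Permutation.Propositional.Properties using (∈-resp-↭)
import Data.List.Relation.Binary.Permutation.Setoid.Properties as PermutationSetoid
open import Data.List.Relation.Unary.All as All using ([]; _∷_)
import Data.List.Relation.Unary.All.Properties as AllP
open import Data.List.Relation.Unary.AllPairs as AllPairs using ([]; _∷_)
open import Data.List.Relation.Unary.Any using (here; there)
open import Data.List.Relation.Unary.Unique.Propositional using (Unique)
open import Data.List.Relation.Unary.Unique.Propositional.Properties using (++⁺; allFin⁺; upTo⁺; applyUpTo⁺₁)
open import Data.Maybe using (just; nothing)
open import Data.Maybe.Properties using (just-injective)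
open import Data.Nat using (zero; suc; _+_; _∸_; _⊔_; _≤_; _<_; z≤n; s≤s; s≤s⁻¹; _<?_; _≟_; >-nonZero⁻¹)
open import Data.Nat.DivMod
  using (_/_; _%_; _mod_; /-congˡ; +-distrib-/-∣ʳ; m<n⇒m/n≡0; m*n/n≡m; [m+kn]%n≡m%n; m<n⇒m%n≡m)
open import Data.Nat.Divisibility using (n∣m*n)
open import Data.Nat.Induction using (<-rec)
open import Data.Nat.Properties
open import Data.Product using (∃₂; _,_; proj₁; proj₂)
open import Data.Sum using (_⊎_; inj₁; inj₂; [_,_]′)
open import Data.Vec using (Vec; []; _∷_; lookup; tabulate)
import Data.Vec.Properties as VecP
open import Function using (_∘_)
open import Function.Bundles using (_⇔_; mk⇔; Equivalence)
open import Relation.Binary.Definitions using (Transitive; Irreflexive; Decidable; tri<; tri≈; tri>)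
open import Relation.Binary.PropositionalEquality
  using (setoid; _≢_; refl; sym; trans; cong; cong₂; subst; subst₂; module ≡-Reasoning)
open import Relation.Nullary using (¬_; Dec; yes; no)

module _ {A : Set} where

  Unique-++⁻ˡ : ∀ {xs ys : List A} → Unique (xs ++ ys) → Unique xs
  Unique-++⁻ˡ {[]}     _       = []
  Unique-++⁻ˡ {x ∷ xs} (a ∷ u) = AllP.++⁻ˡ xs a ∷ Unique-++⁻ˡ u

  Unique-++⁻ʳ : ∀ xs {ys : List A} → Unique (xs ++ ys) → Unique ys
  Unique-++⁻ʳ []       u       = u
  Unique-++⁻ʳ (x ∷ xs) (_ ∷ u) = Unique-++⁻ʳ xs u

  Unique-++⇒Disjoint : ∀ {xs ys : List A} → Unique (xs ++ ys) → Disjoint xs ys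
  Unique-++⇒Disjoint {x ∷ xs} (a ∷ _) (here refl , q) = All.lookup (AllP.++⁻ʳ xs a) q refl
  Unique-++⇒Disjoint {x ∷ xs} (_ ∷ u) (there p   , q) = Unique-++⇒Disjoint u (p , q)

  module _ {P Q : A → Set} (P? : ∀ x → Dec (P x)) (Q? : ∀ x → Dec (Q x)) (P⇒Q : ∀ {x} → P x → Q x) where

    length-filter-mono : ∀ xs → length (filter P? xs) ≤ length (filter Q? xs)
    length-filter-mono []       = z≤n
    length-filter-mono (x ∷ xs) with P? x | Q? x
    ... | yes _  | yes _  = s≤s (length-filter-mono xs)
    ... | yes px | no ¬qx = ⊥-elim (¬qx (P⇒Q px))
    ... | no _   | yes _  = m≤n⇒m≤1+n (length-filter-mono xs)
    ... | no _   | no _   = length-filter-mono xs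

    length-filter-mono-< : ∀ {x xs} → x ∈ xs → Q x → ¬ P x → length (filter P? xs) < length (filter Q? xs)
    length-filter-mono-< {xs = y ∷ ys} (here refl) qx ¬px with P? y | Q? y
    ... | yes py | _      = ⊥-elim (¬px py)
    ... | no _   | yes _  = s≤s (length-filter-mono ys)
    ... | no _   | no ¬qy = ⊥-elim (¬qy qx)
    length-filter-mono-< {xs = y ∷ ys} (there x∈) qx ¬px with P? y | Q? y
    ... | yes _  | yes _  = s≤s (length-filter-mono-< x∈ qx ¬px)
    ... | yes py | no ¬qy = ⊥-elim (¬qy (P⇒Q py))
    ... | no _   | yes _  = m≤n⇒m≤1+n (length-filter-mono-< x∈ qx ¬px)
    ... | no _   | no _   = length-filter-mono-< x∈ qx ¬px

  length-filter-singleton : ∀ {P : A → Set} (P? : ∀ x → Dec (P x)) {x xs} → Unique xs → x ∈ xs →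
                            P x → (∀ {y} → P y → y ≡ x) → length (filter P? xs) ≡ 1
  length-filter-singleton P? {xs = y ∷ ys} (y∉ys ∷ u) x∈ px only with P? y | x∈
  ... | yes _  | here refl = cong (suc ∘ length) (filter-none P? (All.map (λ x≢z pz → x≢z (sym (only pz))) y∉ys))
  ... | yes py | there x∈ys = ⊥-elim (All.lookup y∉ys x∈ys (only py))
  ... | no ¬py | here refl = ⊥-elim (¬py px)
  ... | no _   | there x∈ys = length-filter-singleton P? u x∈ys px only

  length-filter-⊎ : ∀ {P Q R : A → Set} (P? : ∀ x → Dec (P x)) (Q? : ∀ x → Dec (Q x)) (R? : ∀ x → Dec (R x)) →
                    (∀ {x} → P x → Q x ⊎ R x) → (∀ {x} → Q x ⊎ R x → P x) → (∀ {x} → Q x → ¬ R x) →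
                    ∀ xs → length (filter P? xs) ≡ length (filter Q? xs) + length (filter R? xs)
  length-filter-⊎ P? Q? R? split join disjoint []       = refl
  length-filter-⊎ P? Q? R? split join disjoint (x ∷ xs) with P? x | Q? x | R? x
  ... | yes _  | yes _  | no _   = cong suc (length-filter-⊎ P? Q? R? split join disjoint xs)
  ... | yes _  | no _   | yes _  = trans (cong suc (length-filter-⊎ P? Q? R? split join disjoint xs)) (sym (+-suc _ _))
  ... | no _   | no _   | no _   = length-filter-⊎ P? Q? R? split join disjoint xs
  ... | yes _  | yes qx | yes rx = ⊥-elim (disjoint qx rx)
  ... | yes px | no ¬qx | no ¬rx = ⊥-elim ([ ¬qx , ¬rx ]′ (split px))
  ... | no ¬px | yes qx | _      = ⊥-elim (¬px (join (inj₁ qx)))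
  ... | no ¬px | no _   | yes rx = ⊥-elim (¬px (join (inj₂ rx)))

unique∧set⇒↭ : ∀ {A : Set} {xs ys : List A} → Unique xs → Unique ys →
              (∀ {x} → x ∈ xs → x ∈ ys) → (∀ {x} → x ∈ ys → x ∈ xs) → xs ↭ ys
unique∧set⇒↭ uxs uys xs⊆ys ys⊆xs = ∼bag⇒↭ (unique∧set⇒bag uxs uys (mk⇔ xs⊆ys ys⊆xs))

Unique-resp-↭ : ∀ {A : Set} {xs ys : List A} → xs ↭ ys → Unique xs → Unique ys
Unique-resp-↭ {A} xs↭ys = PermutationSetoid.Unique-resp-↭ (setoid A) (↭⇒↭ₛ xs↭ys)

∈-interval⁺ : ∀ {a b x} → a ≤ x → x < b → x ∈ interval a b
∈-interval⁺ {a} {b} a≤x x<b = subst (_∈ interval a b) (m+[n∸m]≡n a≤x) (∈-applyUpTo⁺ (a +_) (∸-monoˡ-< x<b a≤x))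

∈-interval⁻ : ∀ {a b x} → x ∈ interval a b → a ≤ x × x < b
∈-interval⁻ {a} {b} x∈ with ∈-applyUpTo⁻ (a +_) x∈
... | i , i<b∸a , refl = m≤m+n a i , subst (_≤ b) (trans (+-comm (suc i) a) (+-suc a i)) (m≤o∸n⇒m+n≤o (suc i) a≤b i<b∸a)
  where
  a≤b : a ≤ b
  a≤b = <⇒≤ (m∸n≢0⇒n<m (λ b∸a≡0 → n≮0 (subst (i <_) b∸a≡0 i<b∸a)))

interval-unique : ∀ a b → Unique (interval a b)
interval-unique a b = applyUpTo⁺₁ (a +_) (b ∸ a) (λ i<j _ eq → <-irrefl (+-cancelˡ-≡ a _ _ eq) i<j)

module _ {A B : Set} where

  concatMapᵥ : ∀ {m} → (A → List B) → Vec A m → List B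
  concatMapᵥ f []       = []
  concatMapᵥ f (x ∷ xs) = f x ++ concatMapᵥ f xs

  ∈-concatMapᵥ⁺ : ∀ {m} f (xs : Vec A m) {y} r → y ∈ f (lookup xs r) → y ∈ concatMapᵥ f xs
  ∈-concatMapᵥ⁺ f (x ∷ xs) F.zero    y∈ = ∈-++⁺ˡ y∈
  ∈-concatMapᵥ⁺ f (x ∷ xs) (F.suc r) y∈ = ∈-++⁺ʳ (f x) (∈-concatMapᵥ⁺ f xs r y∈)

  ∈-concatMapᵥ⁻ : ∀ {m} f (xs : Vec A m) {y} → y ∈ concatMapᵥ f xs → ∃ λ r → y ∈ f (lookup xs r)
  ∈-concatMapᵥ⁻ f (x ∷ xs) y∈ with ∈-++⁻ (f x) y∈
  ... | inj₁ y∈fx = F.zero , y∈fx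
  ... | inj₂ y∈rest with ∈-concatMapᵥ⁻ f xs y∈rest
  ...   | r , y∈fr = F.suc r , y∈fr

  Unique-concatMapᵥ⁻ : ∀ {m} f (xs : Vec A m) → Unique (concatMapᵥ f xs) → ∀ r → Unique (f (lookup xs r))
  Unique-concatMapᵥ⁻ f (x ∷ xs) u F.zero    = Unique-++⁻ˡ u
  Unique-concatMapᵥ⁻ f (x ∷ xs) u (F.suc r) = Unique-concatMapᵥ⁻ f xs (Unique-++⁻ʳ (f x) u) r

  Unique-concatMapᵥ⇒disjoint : ∀ {m} f (xs : Vec A m) → Unique (concatMapᵥ f xs) →
                               ∀ r r′ {y} → y ∈ f (lookup xs r) → y ∈ f (lookup xs r′) → r ≡ r′
  Unique-concatMapᵥ⇒disjoint f (x ∷ xs) u F.zero      F.zero       _ _ = refl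
  Unique-concatMapᵥ⇒disjoint f (x ∷ xs) u F.zero      (F.suc r′) y∈ y∈′ =
    ⊥-elim (Unique-++⇒Disjoint u (y∈ , ∈-concatMapᵥ⁺ f xs r′ y∈′))
  Unique-concatMapᵥ⇒disjoint f (x ∷ xs) u (F.suc r)   F.zero     y∈ y∈′ =
    ⊥-elim (Unique-++⇒Disjoint u (y∈′ , ∈-concatMapᵥ⁺ f xs r y∈))
  Unique-concatMapᵥ⇒disjoint f (x ∷ xs) u (F.suc r)   (F.suc r′) y∈ y∈′ =
    cong F.suc (Unique-concatMapᵥ⇒disjoint f xs (Unique-++⁻ʳ (f x) u) r r′ y∈ y∈′)

  Unique-concatMapᵥ⁺ : ∀ {m} f (xs : Vec A m) → (∀ r → Unique (f (lookup xs r))) →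
                       (∀ r r′ {y} → y ∈ f (lookup xs r) → y ∈ f (lookup xs r′) → r ≡ r′) →
                       Unique (concatMapᵥ f xs)
  Unique-concatMapᵥ⁺ f []       _ _        = []
  Unique-concatMapᵥ⁺ f (x ∷ xs) u disjoint =
    ++⁺ (u F.zero)
        (Unique-concatMapᵥ⁺ f xs (u ∘ F.suc)
          (λ r r′ y∈ y∈′ → FinP.suc-injective (disjoint (F.suc r) (F.suc r′) y∈ y∈′)))
        (λ (y∈x , y∈rest) → FinP.0≢1+n (disjoint F.zero (F.suc _) y∈x (proj₂ (∈-concatMapᵥ⁻ f xs y∈rest))))

module _ {A : Set} where

  maxOf : ∀ {m} → (A → ℕ) → Vec A m → ℕ
  maxOf f []       = 0
  maxOf f (x ∷ xs) = f x ⊔ maxOf f xs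

  maxOf-lookup : ∀ {m} f (xs : Vec A m) r → f (lookup xs r) ≤ maxOf f xs
  maxOf-lookup f (x ∷ xs) F.zero    = m≤m⊔n _ _
  maxOf-lookup f (x ∷ xs) (F.suc r) = ≤-trans (maxOf-lookup f xs r) (m≤n⊔m (f x) _)

  maxOf-least : ∀ {m} f (xs : Vec A m) {b} → (∀ r → f (lookup xs r) ≤ b) → maxOf f xs ≤ b
  maxOf-least f []       _     = z≤n
  maxOf-least f (x ∷ xs) bound = ⊔-lub (bound F.zero) (maxOf-least f xs (bound ∘ F.suc))

  maxOf-attained : ∀ {m} f (xs : Vec A m) → 0 < m → ∃ λ r → f (lookup xs r) ≡ maxOf f xs
  maxOf-attained f (x ∷ [])     _ = F.zero , sym (⊔-identityʳ _)
  maxOf-attained f (x ∷ xs@(_ ∷ _)) _ with maxOf-attained f xs (s≤s z≤n) | ≤-total (maxOf f xs) (f x)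
  ... | _          | inj₁ rest≤x = F.zero , sym (m≥n⇒m⊔n≡m rest≤x)
  ... | r , attained | inj₂ x≤rest = F.suc r , trans attained (sym (m≤n⇒m⊔n≡n x≤rest))

discrete-ivt : (f : ℕ → ℕ) → (∀ j → f (suc j) ≤ suc (f j)) →
               ∀ {x} b → f 0 ≤ x → x < f b → ∃ λ j → j < b × f j ≡ x × f (suc j) ≡ suc x
discrete-ivt f step zero    f0≤x x<f0 = ⊥-elim (<-irrefl refl (≤-trans x<f0 f0≤x))
discrete-ivt f step {x} (suc b) f0≤x x<f1+b with x <? f b
... | yes x<fb with discrete-ivt f step b f0≤x x<fb
...   | j , j<b , fj≡x , f1+j≡1+x = j , m<n⇒m<1+n j<b , fj≡x , f1+j≡1+x
discrete-ivt f step {x} (suc b) f0≤x x<f1+b | no x≮fb =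
  b , ≤-refl , fb≡x , ≤-antisym (≤-trans (step b) (s≤s (≤-reflexive fb≡x))) x<f1+b
  where
  fb≡x : f b ≡ x
  fb≡x = ≤-antisym (≮⇒≥ x≮fb) (s≤s⁻¹ (≤-trans x<f1+b (step b)))

module _ {A : Set} (R : A → A → Set) {N : ℕ} where

  Linked : (Fin N → A) → Set
  Linked f = ∀ i j → toℕ j ≡ suc (toℕ i) → R (f i) (f j)

  Increasing : (Fin N → A) → Set
  Increasing f = ∀ i j → toℕ i < toℕ j → R (f i) (f j)

module _ {A : Set} {R : A → A → Set} {N : ℕ} {f : Fin N → A} where

  linked⇒increasing : Transitive R → Linked R f → Increasing R f
  linked⇒increasing R-trans link i j i<j = go (toℕ j) j refl i<j
    where
    go : ∀ m (j : Fin N) → toℕ j ≡ m → toℕ i < m → R (f i) (f j)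
    go (suc m) j j≡1+m (s≤s i≤m) with m≤n⇒m<n∨m≡n i≤m
    ... | inj₂ i≡m = link i j (trans j≡1+m (cong suc (sym i≡m)))
    ... | inj₁ i<m = R-trans (go m j′ (FinP.toℕ-fromℕ< m<N) i<m)
                             (link j′ j (trans j≡1+m (cong suc (sym (FinP.toℕ-fromℕ< m<N)))))
      where
      m<N : m < N
      m<N = <-trans (n<1+n m) (subst (_< N) j≡1+m (FinP.toℕ<n j))
      j′ = fromℕ< m<N

  increasing⇒reflects : Irreflexive _≡_ R → Transitive R → Increasing R f →
                        ∀ {i j} → R (f i) (f j) → toℕ i < toℕ j
  increasing⇒reflects R-irrefl R-trans incr {i} {j} fi<fj with <-cmp (toℕ i) (toℕ j)
  ... | tri< i<j _ _ = i<j
  ... | tri≈ _ i≡j _ = ⊥-elim (R-irrefl (cong f (FinP.toℕ-injective i≡j)) fi<fj)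
  ... | tri> _ _ j<i = ⊥-elim (R-irrefl refl (R-trans fi<fj (incr j i j<i)))

increasing⇒inflationary : ∀ {N} {f : Fin N → Fin N} → Increasing F._<_ f → ∀ i → toℕ i ≤ toℕ (f i)
increasing⇒inflationary {N} {f} incr i = go (toℕ i) i refl
  where
  go : ∀ m (i : Fin N) → toℕ i ≡ m → m ≤ toℕ (f i)
  go zero    i _      = z≤n
  go (suc m) i i≡1+m = ≤-trans (s≤s (go m i′ (FinP.toℕ-fromℕ< m<N))) (incr i′ i i′<i)
    where
    m<N : m < N
    m<N = <-trans (n<1+n m) (subst (_< N) i≡1+m (FinP.toℕ<n i))
    i′ = fromℕ< m<N
    i′<i : toℕ i′ < toℕ i
    i′<i = subst₂ _<_ (sym (FinP.toℕ-fromℕ< m<N)) (sym i≡1+m) (n<1+n m)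

increasing-bijection⇒id : ∀ {N} {f g : Fin N → Fin N} → (∀ i → f (g i) ≡ i) → (∀ i → g (f i) ≡ i) →
                          Increasing F._<_ f → ∀ i → f i ≡ i
increasing-bijection⇒id {f = f} {g} fg gf incr i = FinP.toℕ-injective (≤-antisym fi≤i (increasing⇒inflationary incr i))
  where
  g-incr : Increasing F._<_ g
  g-incr i j i<j = increasing⇒reflects FinP.<-irrefl FinP.<-trans incr (subst₂ F._<_ (sym (fg i)) (sym (fg j)) i<j)
  fi≤i : toℕ (f i) ≤ toℕ i
  fi≤i = subst (λ k → toℕ (f i) ≤ toℕ k) (gf i) (increasing⇒inflationary g-incr (f i))

injective⇒surjective : ∀ {N} (f : Fin N → Fin N) → (∀ {x y} → f x ≡ f y → x ≡ y) → ∀ y → ∃ λ x → f x ≡ y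
injective⇒surjective {suc N} f f-inj y with FinP.any? (λ x → f x FinP.≟ y)
... | yes found = found
... | no  ¬found = ⊥-elim (<-irrefl refl (FinP.injective⇒≤ f′-inj))
  where
  f′ : Fin (suc N) → Fin N
  f′ x = F.punchOut {i = y} {j = f x} (λ y≡fx → ¬found (x , sym y≡fx))
  f′-inj : ∀ {a b} → f′ a ≡ f′ b → a ≡ b
  f′-inj {a} {b} = f-inj ∘ FinP.punchOut-injective (λ e → ¬found (a , sym e)) (λ e → ¬found (b , sym e))

module _ {A : Set} {R : A → A → Set} (R-irrefl : Irreflexive _≡_ R) (R-trans : Transitive R) where

  increasing-permutation-unique : ∀ {N} (h : Fin N → A) (π π′ : Permutation′ N) →
                                  Increasing R (h ∘ (π ⟨$⟩ʳ_)) → Increasing R (h ∘ (π′ ⟨$⟩ʳ_)) →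
                                  ∀ k → π ⟨$⟩ʳ k ≡ π′ ⟨$⟩ʳ k
  increasing-permutation-unique h π π′ incr incr′ k =
    trans (cong (π ⟨$⟩ʳ_) (sym (increasing-bijection⇒id ρ∘ρ⁻¹ ρ⁻¹∘ρ ρ-incr k))) (inverseʳ π)
    where
    ρ ρ⁻¹ : Fin _ → Fin _
    ρ   i = π  ⟨$⟩ˡ (π′ ⟨$⟩ʳ i)
    ρ⁻¹ i = π′ ⟨$⟩ˡ (π  ⟨$⟩ʳ i)
    ρ∘ρ⁻¹ : ∀ i → ρ (ρ⁻¹ i) ≡ i
    ρ∘ρ⁻¹ i = trans (cong (π ⟨$⟩ˡ_) (inverseʳ π′)) (inverseˡ π)
    ρ⁻¹∘ρ : ∀ i → ρ⁻¹ (ρ i) ≡ i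
    ρ⁻¹∘ρ i = trans (cong (π′ ⟨$⟩ˡ_) (inverseʳ π)) (inverseˡ π′)
    ρ-incr : Increasing F._<_ ρ
    ρ-incr i j i<j = increasing⇒reflects R-irrefl R-trans incr
      (subst₂ R (cong h (sym (inverseʳ π))) (cong h (sym (inverseʳ π))) (incr′ i j i<j))

  module _ (R? : Decidable R) {N} (h : Fin N → A)
           (comparable : ∀ k l → ¬ R (h k) (h l) → ¬ R (h l) (h k) → k ≡ l) where

    rank : Fin N → ℕ
    rank k = length (filter (λ l → R? (h l) (h k)) (allFin N))

    rank<N : ∀ k → rank k < N
    rank<N k = subst (rank k <_) (length-tabulate (λ l → l))
      (filter-notAll (λ l → R? (h l) (h k)) (allFin N) (lose (∈-allFin k) (R-irrefl refl)))

    rank-mono : ∀ {k l} → R (h k) (h l) → rank k < rank l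
    rank-mono {k} {l} hk<hl = length-filter-mono-< (λ m → R? (h m) (h k)) (λ m → R? (h m) (h l))
      (λ hm<hk → R-trans hm<hk hk<hl) (∈-allFin k) hk<hl (R-irrefl refl)

    position : Fin N → Fin N
    position k = fromℕ< (rank<N k)

    toℕ-position : ∀ k → toℕ (position k) ≡ rank k
    toℕ-position k = FinP.toℕ-fromℕ< (rank<N k)

    position-injective : ∀ {k l} → position k ≡ position l → k ≡ l
    position-injective {k} {l} eq = comparable k l (<-irrefl rank≡ ∘ rank-mono) (<-irrefl (sym rank≡) ∘ rank-mono)
      where
      rank≡ : rank k ≡ rank l
      rank≡ = trans (sym (toℕ-position k)) (trans (cong toℕ eq) (toℕ-position l))

    sortingPermutation : Permutation′ N
    sortingPermutation = permutation unrank position (λ k → position-injective (position∘unrank (position k))) position∘unrank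
      where
      unrank : Fin N → Fin N
      unrank i = proj₁ (injective⇒surjective position position-injective i)
      position∘unrank : ∀ i → position (unrank i) ≡ i
      position∘unrank i = proj₂ (injective⇒surjective position position-injective i)

    rank∘sortingPermutation : ∀ i → rank (sortingPermutation ⟨$⟩ʳ i) ≡ toℕ i
    rank∘sortingPermutation i = trans (sym (toℕ-position _)) (cong toℕ (inverseˡ sortingPermutation))

    sorted : Fin N → A
    sorted = h ∘ (sortingPermutation ⟨$⟩ʳ_)

    sorted-increasing : Increasing R sorted
    sorted-increasing i j i<j with R? (sorted i) (sorted j) | R? (sorted j) (sorted i)
    ... | yes i<j′ | _          = i<j′
    ... | no _     | yes j<i′  =
      ⊥-elim (<-asym i<j (subst₂ _<_ (rank∘sortingPermutation j) (rank∘sortingPermutation i) (rank-mono j<i′)))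
    ... | no i≮j   | no j≮i    = ⊥-elim (<-irrefl (cong toℕ i≡j) i<j)
      where
      i≡j : i ≡ j
      i≡j = trans (sym (inverseˡ sortingPermutation))
                  (trans (cong position (comparable _ _ i≮j j≮i)) (inverseˡ sortingPermutation))

-- Subtrees and labels

module _ {d : ℕ} where

  label : Tree d → ℕ
  label (leaf p)   = p
  label (node q _) = q

  mutual
    labels : Tree d → List ℕ
    labels (leaf p)    = [ p ]
    labels (node q us) = q ∷ labelss us

    labelss : ∀ {m} → Vec (Tree d) m → List ℕ
    labelss []       = []
    labelss (u ∷ us) = labels u ++ labelss us

  infix 4 _⊑_
  data _⊑_ : Tree d → Tree d → Set where
    here  : ∀ {u} → u ⊑ u
    there : ∀ {u q us} (r : Fin d) → u ⊑ lookup us r → u ⊑ node q us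

  ⊑-trans : ∀ {u v w} → u ⊑ v → v ⊑ w → u ⊑ w
  ⊑-trans u⊑v here          = u⊑v
  ⊑-trans u⊑v (there r v⊑w) = there r (⊑-trans u⊑v v⊑w)

  child-⊑ : ∀ {q us} r → lookup us r ⊑ node q us
  child-⊑ r = there r here

  module _ (P : Tree d → Set) (leaf-case : ∀ p → P (leaf p))
           (node-case : ∀ q us → (∀ r → P (lookup us r)) → P (node q us)) where
    mutual
      Tree-ind : ∀ t → P t
      Tree-ind (leaf p)    = leaf-case p
      Tree-ind (node q us) = node-case q us (Vec-ind us)

      Vec-ind : ∀ {m} (us : Vec (Tree d) m) r → P (lookup us r)
      Vec-ind (u ∷ us) F.zero    = Tree-ind u
      Vec-ind (u ∷ us) (F.suc r) = Vec-ind us r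

  labelss≡ : ∀ {m} (us : Vec (Tree d) m) → labelss us ≡ concatMapᵥ labels us
  labelss≡ []       = refl
  labelss≡ (u ∷ us) = cong (labels u ++_) (labelss≡ us)

  nodeLabelss≡ : ∀ {m} (us : Vec (Tree d) m) → nodeLabelss us ≡ concatMapᵥ nodeLabels us
  nodeLabelss≡ []       = refl
  nodeLabelss≡ (u ∷ us) = cong (nodeLabels u ++_) (nodeLabelss≡ us)

  leafLabelss≡ : ∀ {m} (us : Vec (Tree d) m) → leafLabelss us ≡ concatMapᵥ leafLabels us
  leafLabelss≡ []       = refl
  leafLabelss≡ (u ∷ us) = cong (leafLabels u ++_) (leafLabelss≡ us)

  module _ {m} (us : Vec (Tree d) m) where

    ∈-labelss⁺ : ∀ {x} r → x ∈ labels (lookup us r) → x ∈ labelss us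
    ∈-labelss⁺ r x∈ = subst (_ ∈_) (sym (labelss≡ us)) (∈-concatMapᵥ⁺ labels us r x∈)

    ∈-labelss⁻ : ∀ {x} → x ∈ labelss us → ∃ λ r → x ∈ labels (lookup us r)
    ∈-labelss⁻ x∈ = ∈-concatMapᵥ⁻ labels us (subst (_ ∈_) (labelss≡ us) x∈)

    ∈-nodeLabelss⁺ : ∀ {x} r → x ∈ nodeLabels (lookup us r) → x ∈ nodeLabelss us
    ∈-nodeLabelss⁺ r x∈ = subst (_ ∈_) (sym (nodeLabelss≡ us)) (∈-concatMapᵥ⁺ nodeLabels us r x∈)

    ∈-nodeLabelss⁻ : ∀ {x} → x ∈ nodeLabelss us → ∃ λ r → x ∈ nodeLabels (lookup us r)
    ∈-nodeLabelss⁻ x∈ = ∈-concatMapᵥ⁻ nodeLabels us (subst (_ ∈_) (nodeLabelss≡ us) x∈)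

    ∈-leafLabelss⁺ : ∀ {x} r → x ∈ leafLabels (lookup us r) → x ∈ leafLabelss us
    ∈-leafLabelss⁺ r x∈ = subst (_ ∈_) (sym (leafLabelss≡ us)) (∈-concatMapᵥ⁺ leafLabels us r x∈)

    ∈-leafLabelss⁻ : ∀ {x} → x ∈ leafLabelss us → ∃ λ r → x ∈ leafLabels (lookup us r)
    ∈-leafLabelss⁻ x∈ = ∈-concatMapᵥ⁻ leafLabels us (subst (_ ∈_) (leafLabelss≡ us) x∈)

  label∈labels : ∀ u → label u ∈ labels u
  label∈labels (leaf p)   = here refl
  label∈labels (node q _) = here refl

  ∈-labels⁺ : ∀ {w u x} → w ⊑ u → x ∈ labels w → x ∈ labels u
  ∈-labels⁺ here               x∈ = x∈
  ∈-labels⁺ (there {us = us} r w⊑) x∈ = there (∈-labelss⁺ us r (∈-labels⁺ w⊑ x∈))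

  ∈-labels⁻ : ∀ u {x} → x ∈ labels u → ∃ λ w → w ⊑ u × label w ≡ x
  ∈-labels⁻ = Tree-ind _ (λ { p (here refl) → leaf p , here , refl }) node-case
    where
    node-case : ∀ q us → (∀ r {x} → x ∈ labels (lookup us r) → ∃ λ w → w ⊑ lookup us r × label w ≡ x) →
                ∀ {x} → x ∈ labels (node q us) → ∃ λ w → w ⊑ node q us × label w ≡ x
    node-case q us ih (here refl) = node q us , here , refl
    node-case q us ih (there x∈) with ∈-labelss⁻ us x∈
    ... | r , x∈r with ih r x∈r
    ...   | w , w⊑ , refl = w , there r w⊑ , refl

  ∈-nodeLabels⁺ : ∀ {x cs u} → node x cs ⊑ u → x ∈ nodeLabels u
  ∈-nodeLabels⁺ here                    = here refl
  ∈-nodeLabels⁺ (there {us = us} r x⊑) = there (∈-nodeLabelss⁺ us r (∈-nodeLabels⁺ x⊑))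

  ∈-leafLabels⁺ : ∀ {x u} → leaf x ⊑ u → x ∈ leafLabels u
  ∈-leafLabels⁺ here                    = here refl
  ∈-leafLabels⁺ (there {us = us} r x⊑) = ∈-leafLabelss⁺ us r (∈-leafLabels⁺ x⊑)

  ∈-nodeLabels⁻ : ∀ u {x} → x ∈ nodeLabels u → ∃ λ cs → node x cs ⊑ u
  ∈-nodeLabels⁻ = Tree-ind _ (λ _ ()) node-case
    where
    node-case : ∀ q us → (∀ r {x} → x ∈ nodeLabels (lookup us r) → ∃ λ cs → node x cs ⊑ lookup us r) →
                ∀ {x} → x ∈ nodeLabels (node q us) → ∃ λ cs → node x cs ⊑ node q us
    node-case q us ih (here refl) = us , here
    node-case q us ih (there x∈) with ∈-nodeLabelss⁻ us x∈
    ... | r , x∈r with ih r x∈r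
    ...   | cs , x⊑ = cs , there r x⊑

  ∈-leafLabels⁻ : ∀ u {x} → x ∈ leafLabels u → leaf x ⊑ u
  ∈-leafLabels⁻ = Tree-ind _ (λ { p (here refl) → here }) node-case
    where
    node-case : ∀ q us → (∀ r {x} → x ∈ leafLabels (lookup us r) → leaf x ⊑ lookup us r) →
                ∀ {x} → x ∈ leafLabels (node q us) → leaf x ⊑ node q us
    node-case q us ih x∈ with ∈-leafLabelss⁻ us x∈
    ... | r , x∈r = there r (ih r x∈r)

  nodeLabels⊆labels : ∀ {u x} → x ∈ nodeLabels u → x ∈ labels u
  nodeLabels⊆labels {u} x∈ = ∈-labels⁺ (proj₂ (∈-nodeLabels⁻ u x∈)) (here refl)

  leafLabels⊆labels : ∀ {u x} → x ∈ leafLabels u → x ∈ labels u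
  leafLabels⊆labels {u} x∈ = ∈-labels⁺ (∈-leafLabels⁻ u x∈) (here refl)

  labels⊆nodeLabels∪leafLabels : ∀ {u x} → x ∈ labels u → x ∈ nodeLabels u ⊎ x ∈ leafLabels u
  labels⊆nodeLabels∪leafLabels {u} x∈ with ∈-labels⁻ u x∈
  ... | leaf _   , x⊑ , refl = inj₂ (∈-leafLabels⁺ x⊑)
  ... | node _ _ , x⊑ , refl = inj₁ (∈-nodeLabels⁺ x⊑)

  heights≡maxOf : ∀ {m} (us : Vec (Tree d) m) → heights us ≡ maxOf height us
  heights≡maxOf []       = refl
  heights≡maxOf (u ∷ us) = cong (height u ⊔_) (heights≡maxOf us)

  maxleafs≡maxOf : ∀ {m} (us : Vec (Tree d) m) → maxleafs us ≡ maxOf maxleaf us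
  maxleafs≡maxOf []       = refl
  maxleafs≡maxOf (u ∷ us) = cong (maxleaf u ⊔_) (maxleafs≡maxOf us)

  height-lookup : ∀ {m} (us : Vec (Tree d) m) r → height (lookup us r) ≤ heights us
  height-lookup us r = ≤-trans (maxOf-lookup height us r) (≤-reflexive (sym (heights≡maxOf us)))

  maxleaf-lookup : ∀ {m} (us : Vec (Tree d) m) r → maxleaf (lookup us r) ≤ maxleafs us
  maxleaf-lookup us r = ≤-trans (maxOf-lookup maxleaf us r) (≤-reflexive (sym (maxleafs≡maxOf us)))

  ⊑-height : ∀ {w u} → w ⊑ u → height w ≤ height u
  ⊑-height here                   = ≤-refl
  ⊑-height (there {us = us} r w⊑) = ≤-trans (⊑-height w⊑) (m≤n⇒m≤1+n (height-lookup us r))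

  ⊑-maxleaf : ∀ {w u} → w ⊑ u → maxleaf w ≤ maxleaf u
  ⊑-maxleaf here                   = ≤-refl
  ⊑-maxleaf (there {us = us} r w⊑) = ≤-trans (⊑-maxleaf w⊑) (maxleaf-lookup us r)

  ⊑-child-height : ∀ {w q} us r → w ⊑ lookup us r → height w < height (node q us)
  ⊑-child-height us r w⊑ = s≤s (≤-trans (⊑-height w⊑) (height-lookup us r))

  ⊑-height-≡⇒≡ : ∀ {w u} → w ⊑ u → height w ≡ height u → w ≡ u
  ⊑-height-≡⇒≡ here         _  = refl
  ⊑-height-≡⇒≡ (there {q = q} {us} r w⊑) eq = ⊥-elim (<-irrefl eq (⊑-child-height {q = q} us r w⊑))

  leaf-maxleaf-⊑ : 0 < d → ∀ u → leaf (maxleaf u) ⊑ u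
  leaf-maxleaf-⊑ 0<d = Tree-ind _ (λ _ → here) node-case
    where
    node-case : ∀ q us → (∀ r → leaf (maxleaf (lookup us r)) ⊑ lookup us r) → leaf (maxleaf (node q us)) ⊑ node q us
    node-case q us ih with maxOf-attained maxleaf us 0<d
    ... | r , attained = there r (subst (λ m → leaf m ⊑ lookup us r) (trans attained (sym (maxleafs≡maxOf us))) (ih r))

  record DistinctLabels (t : Tree d) : Set where
    constructor distinct
    field unique : Unique (labels t)

  module _ {q us} (dl : DistinctLabels (node q us)) where
    private
      unique-children : Unique (concatMapᵥ labels us)
      unique-children = subst Unique (labelss≡ us) (AllPairs.tail (DistinctLabels.unique dl))

    root∉children : ∀ r → q ∉ labels (lookup us r)
    root∉children r q∈ =
      All.lookup (AllPairs.head (DistinctLabels.unique dl)) (∈-labelss⁺ us r q∈) refl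

    children-distinct : ∀ r → DistinctLabels (lookup us r)
    children-distinct r = distinct (Unique-concatMapᵥ⁻ labels us unique-children r)

    children-disjoint : ∀ r r′ {x} → x ∈ labels (lookup us r) → x ∈ labels (lookup us r′) → r ≡ r′
    children-disjoint = Unique-concatMapᵥ⇒disjoint labels us unique-children

  node-distinct : ∀ {q us} → (∀ r → q ∉ labels (lookup us r)) → (∀ r → DistinctLabels (lookup us r)) →
                  (∀ r r′ {x} → x ∈ labels (lookup us r) → x ∈ labels (lookup us r′) → r ≡ r′) →
                  DistinctLabels (node q us)
  node-distinct {q} {us} q∉ dls disjoint = distinct (All.tabulate q∉children ∷ subst Unique (sym (labelss≡ us))
    (Unique-concatMapᵥ⁺ labels us (DistinctLabels.unique ∘ dls) disjoint))
    where
    q∉children : ∀ {x} → x ∈ labelss us → q ≢ x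
    q∉children x∈ refl with ∈-labelss⁻ us x∈
    ... | r , q∈ = q∉ r q∈

  ⊑-distinct : ∀ {w t} → w ⊑ t → DistinctLabels t → DistinctLabels w
  ⊑-distinct here         dl = dl
  ⊑-distinct (there r w⊑) dl = ⊑-distinct w⊑ (children-distinct dl r)

  ⊑-nested : ∀ {t u w x} → DistinctLabels t → u ⊑ t → w ⊑ t → x ∈ labels u → x ∈ labels w → u ⊑ w ⊎ w ⊑ u
  ⊑-nested dl here          w⊑             _   _   = inj₂ w⊑
  ⊑-nested dl u⊑@(there _ _) here          _   _   = inj₁ u⊑
  ⊑-nested dl (there r u⊑) (there r′ w⊑) x∈u x∈w
    with children-disjoint dl r r′ (∈-labels⁺ u⊑ x∈u) (∈-labels⁺ w⊑ x∈w)
  ... | refl = ⊑-nested (children-distinct dl r) u⊑ w⊑ x∈u x∈w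

  mutual
    childrenOf-∉ : ∀ {q} u → q ∉ labels u → childrenOf q u ≡ nothing
    childrenOf-∉     (leaf p)     _  = refl
    childrenOf-∉ {q} (node q′ us) q∉ with q ≟ q′
    ... | yes refl = ⊥-elim (q∉ (here refl))
    ... | no _     = childrenOfs-∉ us (q∉ ∘ there)

    childrenOfs-∉ : ∀ {q m} (us : Vec (Tree d) m) → q ∉ labelss us → childrenOfs q us ≡ nothing
    childrenOfs-∉     []       _  = refl
    childrenOfs-∉ {q} (u ∷ us) q∉ rewrite childrenOf-∉ {q} u (q∉ ∘ ∈-++⁺ˡ) =
      childrenOfs-∉ us (q∉ ∘ ∈-++⁺ʳ (labels u))

  childrenOfs-lookup : ∀ {q m cs} (us : Vec (Tree d) m) r → childrenOf q (lookup us r) ≡ just cs →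
                       (∀ r′ → q ∈ labels (lookup us r′) → r′ ≡ r) → childrenOfs q us ≡ just cs
  childrenOfs-lookup     (u ∷ us) F.zero    found _    rewrite found = refl
  childrenOfs-lookup {q} (u ∷ us) (F.suc r) found only rewrite childrenOf-∉ {q} u (FinP.0≢1+n ∘ only F.zero) =
    childrenOfs-lookup us r found (λ r′ → FinP.suc-injective ∘ only (F.suc r′))

  childrenOf-⊑ : ∀ {t q cs} → DistinctLabels t → node q cs ⊑ t → childrenOf q t ≡ just cs
  childrenOf-⊑ {node q cs} {q} dl here with q ≟ q
  ... | yes _ = refl
  ... | no q≢q = ⊥-elim (q≢q refl)
  childrenOf-⊑ {node q′ us} {q} dl (there r q⊑) with q ≟ q′
  ... | yes refl = ⊥-elim (root∉children dl r (∈-labels⁺ q⊑ (here refl)))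
  ... | no _     = childrenOfs-lookup us r (childrenOf-⊑ (children-distinct dl r) q⊑)
                     (λ r′ q∈ → children-disjoint dl r′ r q∈ (∈-labels⁺ q⊑ (here refl)))

  distinct⇒nodeLabels-unique : ∀ t → DistinctLabels t → Unique (nodeLabels t)
  distinct⇒nodeLabels-unique = Tree-ind _ (λ _ _ → []) node-case
    where
    node-case : ∀ q us → (∀ r → DistinctLabels (lookup us r) → Unique (nodeLabels (lookup us r))) →
                DistinctLabels (node q us) → Unique (nodeLabels (node q us))
    node-case q us ih dl = All.tabulate q∉ ∷ subst Unique (sym (nodeLabelss≡ us))
      (Unique-concatMapᵥ⁺ nodeLabels us (λ r → ih r (children-distinct dl r))
        (λ r r′ x∈ x∈′ → children-disjoint dl r r′ (nodeLabels⊆labels x∈) (nodeLabels⊆labels x∈′)))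
      where
      q∉ : ∀ {x} → x ∈ nodeLabelss us → q ≢ x
      q∉ x∈ refl with ∈-nodeLabelss⁻ us x∈
      ... | r , q∈ = root∉children dl r (nodeLabels⊆labels q∈)

  distinct⇒leafLabels-unique : ∀ t → DistinctLabels t → Unique (leafLabels t)
  distinct⇒leafLabels-unique = Tree-ind _ (λ _ _ → [] ∷ []) node-case
    where
    node-case : ∀ q us → (∀ r → DistinctLabels (lookup us r) → Unique (leafLabels (lookup us r))) →
                DistinctLabels (node q us) → Unique (leafLabels (node q us))
    node-case q us ih dl = subst Unique (sym (leafLabelss≡ us))
      (Unique-concatMapᵥ⁺ leafLabels us (λ r → ih r (children-distinct dl r))
        (λ r r′ x∈ x∈′ → children-disjoint dl r r′ (leafLabels⊆labels x∈) (leafLabels⊆labels x∈′)))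

  unique⇒distinct : ∀ t → Unique (nodeLabels t) → Unique (leafLabels t) → Disjoint (nodeLabels t) (leafLabels t) →
                    DistinctLabels t
  unique⇒distinct = Tree-ind _ (λ _ _ _ _ → distinct ([] ∷ [])) node-case
    where
    node-case : ∀ q us →
                (∀ r → Unique (nodeLabels (lookup us r)) → Unique (leafLabels (lookup us r)) →
                       Disjoint (nodeLabels (lookup us r)) (leafLabels (lookup us r)) → DistinctLabels (lookup us r)) →
                Unique (q ∷ nodeLabelss us) → Unique (leafLabelss us) → Disjoint (q ∷ nodeLabelss us) (leafLabelss us) →
                DistinctLabels (node q us)
    node-case q us ih (q∉nodes ∷ un) uf disj = node-distinct q∉
      (λ r → ih r (Unique-concatMapᵥ⁻ nodeLabels us un′ r) (Unique-concatMapᵥ⁻ leafLabels us uf′ r)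
                  (λ (x∈n , x∈l) → disj (there (∈-nodeLabelss⁺ us r x∈n) , ∈-leafLabelss⁺ us r x∈l)))
      (λ r r′ x∈ x∈′ → disjoint r r′ (labels⊆nodeLabels∪leafLabels x∈) (labels⊆nodeLabels∪leafLabels x∈′))
      where
      un′ = subst Unique (nodeLabelss≡ us) un
      uf′ = subst Unique (leafLabelss≡ us) uf
      q∉ : ∀ r → q ∉ labels (lookup us r)
      q∉ r q∈ with labels⊆nodeLabels∪leafLabels q∈
      ... | inj₁ q∈n = All.lookup q∉nodes (∈-nodeLabelss⁺ us r q∈n) refl
      ... | inj₂ q∈l = disj (here refl , ∈-leafLabelss⁺ us r q∈l)
      disjoint : ∀ r r′ {x} → x ∈ nodeLabels (lookup us r) ⊎ x ∈ leafLabels (lookup us r) →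
                 x ∈ nodeLabels (lookup us r′) ⊎ x ∈ leafLabels (lookup us r′) → r ≡ r′
      disjoint r r′ (inj₁ x∈n) (inj₁ x∈n′) = Unique-concatMapᵥ⇒disjoint nodeLabels us un′ r r′ x∈n x∈n′
      disjoint r r′ (inj₂ x∈l) (inj₂ x∈l′) = Unique-concatMapᵥ⇒disjoint leafLabels us uf′ r r′ x∈l x∈l′
      disjoint r r′ (inj₁ x∈n) (inj₂ x∈l′) =
        ⊥-elim (disj (there (∈-nodeLabelss⁺ us r x∈n) , ∈-leafLabelss⁺ us r′ x∈l′))
      disjoint r r′ (inj₂ x∈l) (inj₁ x∈n′) =
        ⊥-elim (disj (there (∈-nodeLabelss⁺ us r′ x∈n′) , ∈-leafLabelss⁺ us r x∈l))

-- The order ≺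

module _ {d : ℕ} where

  ≺-trans : Transitive (_≺_ {d})
  ≺-trans (inj₁ a<b)        (inj₁ b<c)        = inj₁ (<-trans a<b b<c)
  ≺-trans (inj₁ a<b)        (inj₂ (b≡c , _))  = inj₁ (subst (_ <_) b≡c a<b)
  ≺-trans (inj₂ (a≡b , _))  (inj₁ b<c)        = inj₁ (subst (_< _) (sym a≡b) b<c)
  ≺-trans (inj₂ (a≡b , ha)) (inj₂ (b≡c , hb)) = inj₂ (trans a≡b b≡c , <-trans ha hb)

  ≺-irrefl : Irreflexive _≡_ (_≺_ {d})
  ≺-irrefl refl (inj₁ a<a)       = <-irrefl refl a<a
  ≺-irrefl refl (inj₂ (_ , h<h)) = <-irrefl refl h<h

  ≺-asym : ∀ {u v : Tree d} → u ≺ v → ¬ v ≺ u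
  ≺-asym u≺v v≺u = ≺-irrefl refl (≺-trans u≺v v≺u)

  _≺?_ : Decidable (_≺_ {d})
  u ≺? v with maxleaf u <? maxleaf v | maxleaf u ≟ maxleaf v | height u <? height v
  ... | yes m<m′ | _        | _        = yes (inj₁ m<m′)
  ... | no _     | yes m≡m′ | yes h<h′ = yes (inj₂ (m≡m′ , h<h′))
  ... | no m≮m′  | yes _    | no h≮h′  = no λ { (inj₁ m<m′) → m≮m′ m<m′ ; (inj₂ (_ , h<h′)) → h≮h′ h<h′ }
  ... | no m≮m′  | no m≢m′  | _        = no λ { (inj₁ m<m′) → m≮m′ m<m′ ; (inj₂ (m≡m′ , _)) → m≢m′ m≡m′ }

  ≺-incomparable : ∀ {u v : Tree d} → ¬ u ≺ v → ¬ v ≺ u → maxleaf u ≡ maxleaf v × height u ≡ height v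
  ≺-incomparable {u} {v} u⊀v v⊀u with <-cmp (maxleaf u) (maxleaf v) | <-cmp (height u) (height v)
  ... | tri< m<m′ _ _ | _              = ⊥-elim (u⊀v (inj₁ m<m′))
  ... | tri> _ _ m>m′ | _              = ⊥-elim (v⊀u (inj₁ m>m′))
  ... | tri≈ _ m≡m′ _ | tri< h<h′ _ _ = ⊥-elim (u⊀v (inj₂ (m≡m′ , h<h′)))
  ... | tri≈ _ m≡m′ _ | tri> _ _ h>h′ = ⊥-elim (v⊀u (inj₂ (sym m≡m′ , h>h′)))
  ... | tri≈ _ m≡m′ _ | tri≈ _ h≡h′ _ = m≡m′ , h≡h′

  ≺⇒maxleaf-≤ : ∀ {u v : Tree d} → u ≺ v → maxleaf u ≤ maxleaf v
  ≺⇒maxleaf-≤ (inj₁ m<m′)       = <⇒≤ m<m′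
  ≺⇒maxleaf-≤ (inj₂ (m≡m′ , _)) = ≤-reflexive m≡m′

  ≺∧maxleaf-≡⇒height-< : ∀ {u v : Tree d} → u ≺ v → maxleaf u ≡ maxleaf v → height u < height v
  ≺∧maxleaf-≡⇒height-< (inj₁ m<m′)       m≡m′ = ⊥-elim (<-irrefl m≡m′ m<m′)
  ≺∧maxleaf-≡⇒height-< (inj₂ (_ , h<h′)) _    = h<h′

  maxleaf-≤∧height-<⇒≺ : ∀ {u v : Tree d} → maxleaf u ≤ maxleaf v → height u < height v → u ≺ v
  maxleaf-≤∧height-<⇒≺ m≤m′ h<h′ with m≤n⇒m<n∨m≡n m≤m′
  ... | inj₁ m<m′ = inj₁ m<m′
  ... | inj₂ m≡m′ = inj₂ (m≡m′ , h<h′)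

  ≺-⊑-trans : ∀ {u v w : Tree d} → u ≺ v → v ⊑ w → u ≺ w
  ≺-⊑-trans (inj₁ m<m′)        v⊑w = inj₁ (<-≤-trans m<m′ (⊑-maxleaf v⊑w))
  ≺-⊑-trans (inj₂ (m≡m′ , h<h′)) v⊑w =
    maxleaf-≤∧height-<⇒≺ (≤-trans (≤-reflexive m≡m′) (⊑-maxleaf v⊑w)) (<-≤-trans h<h′ (⊑-height v⊑w))

  ⊑-child-≺ : ∀ {w q} us r → w ⊑ lookup us r → w ≺ node q us
  ⊑-child-≺ {q = q} us r w⊑ =
    maxleaf-≤∧height-<⇒≺ {v = node q us} (⊑-maxleaf (there {q = q} {us} r w⊑)) (⊑-child-height {q = q} us r w⊑)

  ≺-leaf : ∀ {u : Tree d} {p} → u ≺ leaf p → maxleaf u < p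
  ≺-leaf (inj₁ m<p) = m<p

  ⊑-root-or-child : ∀ {u t : Tree d} → u ⊑ t → u ≡ t ⊎ ∃₂ λ a cs → ∃ λ r → node a cs ⊑ t × lookup cs r ≡ u
  ⊑-root-or-child here = inj₁ refl
  ⊑-root-or-child (there {q = q} {us} r u⊑) with ⊑-root-or-child u⊑
  ... | inj₁ refl                   = inj₂ (q , us , r , here , refl)
  ... | inj₂ (a , cs , r′ , a⊑ , eq) = inj₂ (a , cs , r′ , there r a⊑ , eq)

  module _ {t : Tree d} (dl : DistinctLabels t) where

    private
      nested-parent : ∀ {a b cs cs′ r r′} → node b cs′ ⊑ t → node a cs ⊑ node b cs′ →
                      lookup cs r ≡ lookup cs′ r′ → a ≡ b × r ≡ r′
      nested-parent {cs = cs} {r = r} {r′} b⊑ here eq =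
        refl , children-disjoint (⊑-distinct b⊑ dl) r r′ (label∈labels _)
                                 (subst (λ u → label (lookup cs r) ∈ labels u) eq (label∈labels _))
      nested-parent {a} {cs = cs} {cs′} {r} {r′} b⊑ (there r″ a⊑) eq
        with children-disjoint (⊑-distinct b⊑ dl) r″ r′
               (∈-labels⁺ (⊑-trans (child-⊑ {q = a} {cs} r) a⊑) (label∈labels _))
               (subst (λ u → label (lookup cs r) ∈ labels u) eq (label∈labels _))
      ... | refl = ⊥-elim (<-irrefl refl (<-≤-trans (⊑-child-height {q = a} cs r here)
                                                    (subst (height (node a cs) ≤_) (cong height (sym eq)) (⊑-height a⊑))))

    unique-parent : ∀ {a b cs cs′ r r′} → node a cs ⊑ t → node b cs′ ⊑ t →
                    lookup cs r ≡ lookup cs′ r′ → a ≡ b × r ≡ r′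
    unique-parent {a} {b} {cs} {cs′} {r} {r′} a⊑ b⊑ eq
      with ⊑-nested dl a⊑ b⊑ (∈-labels⁺ (child-⊑ {q = a} {cs} r) (label∈labels _))
             (∈-labels⁺ (child-⊑ {q = b} {cs′} r′) (subst (λ u → label (lookup cs r) ∈ labels u) eq (label∈labels _)))
    ... | inj₁ a⊑b = nested-parent b⊑ a⊑b eq
    ... | inj₂ b⊑a with nested-parent a⊑ b⊑a (sym eq)
    ...   | b≡a , r′≡r = sym b≡a , sym r′≡r

    incomparable⇒≡ : 0 < d → ∀ {u w} → u ⊑ t → w ⊑ t → ¬ u ≺ w → ¬ w ≺ u → u ≡ w
    incomparable⇒≡ 0<d {u} {w} u⊑ w⊑ u⊀w w⊀u with ≺-incomparable u⊀w w⊀u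
    ... | m≡m′ , h≡h′ with ⊑-nested dl u⊑ w⊑ (∈-labels⁺ (leaf-maxleaf-⊑ 0<d u) (here refl))
                                             (subst (_∈ labels w) (sym m≡m′) (∈-labels⁺ (leaf-maxleaf-⊑ 0<d w) (here refl)))
    ...   | inj₁ u⊑w = ⊑-height-≡⇒≡ u⊑w h≡h′
    ...   | inj₂ w⊑u = sym (⊑-height-≡⇒≡ w⊑u (sym h≡h′))

    ⊑-maxleaf-child : 0 < d → ∀ {a cs w} → node a cs ⊑ t → w ⊑ t →
                      maxleaf w ≡ maxleafs cs → height w < height (node a cs) →
                      ∀ r₀ → maxleaf (lookup cs r₀) ≡ maxleafs cs → w ⊑ lookup cs r₀
    ⊑-maxleaf-child 0<d {a} {cs} {w} a⊑ w⊑ m≡ h< r₀ m₀≡ =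
      [ (λ w⊑a → below-root w⊑a h< M∈w) , (λ a⊑w → ⊥-elim (<⇒≱ h< (⊑-height a⊑w))) ]′
        (⊑-nested dl w⊑ a⊑ M∈w (∈-labels⁺ (child-⊑ {q = a} {cs} r₀) M∈r₀))
      where
      M∈w : maxleaf w ∈ labels w
      M∈w = ∈-labels⁺ (leaf-maxleaf-⊑ 0<d w) (here refl)
      M∈r₀ : maxleaf w ∈ labels (lookup cs r₀)
      M∈r₀ = subst (_∈ labels (lookup cs r₀)) (trans m₀≡ (sym m≡)) (∈-labels⁺ (leaf-maxleaf-⊑ 0<d _) (here refl))
      below-root : ∀ {u} → u ⊑ node a cs → height u < height (node a cs) → maxleaf w ∈ labels u → u ⊑ lookup cs r₀
      below-root here          h<′ _   = ⊥-elim (<-irrefl refl h<′)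
      below-root (there r u⊑r) _   M∈u with children-disjoint (⊑-distinct a⊑ dl) r r₀ (∈-labels⁺ u⊑r M∈u) M∈r₀
      ... | refl = u⊑r

module Indexing (d n : ℕ) where

  -- Definitionally equal to TMap.idx, which is only available inside TMap d n π.
  index : Fin n → Fin d → Fin (d * n)
  index q r = cast (*-comm n d) (combine q r)

  split : Fin (d * n) → Fin n × Fin d
  split k = remQuot d (cast (*-comm d n) k)

  index-split : ∀ k → index (proj₁ (split k)) (proj₂ (split k)) ≡ k
  index-split k = trans (cong (cast (*-comm n d)) (FinP.combine-remQuot {n} d (cast (*-comm d n) k)))
                        (FinP.cast-involutive (*-comm n d) (*-comm d n) k)

  split-index : ∀ q r → split (index q r) ≡ (q , r)
  split-index q r = trans (cong (remQuot d) (FinP.cast-involutive (*-comm d n) (*-comm n d) (combine q r)))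
                          (FinP.remQuot-combine q r)

  split-injective : ∀ {k l} → split k ≡ split l → k ≡ l
  split-injective {k} {l} eq =
    trans (sym (index-split k)) (trans (cong (λ (q , r) → index q r) eq) (index-split l))

  index-injective : ∀ {q r q′ r′} → index q r ≡ index q′ r′ → q ≡ q′ × r ≡ r′
  index-injective {q} {r} {q′} {r′} eq with trans (sym (split-index q r)) (trans (cong split eq) (split-index q′ r′))
  ... | refl = refl , refl

  toℕ-index : ∀ q r → toℕ (index q r) ≡ toℕ r + toℕ q * d
  toℕ-index q r = begin
    toℕ (index q r)      ≡⟨ FinP.toℕ-cast (*-comm n d) (combine q r) ⟩
    toℕ (combine q r)    ≡⟨ FinP.toℕ-combine q r ⟩
    d * toℕ q + toℕ r    ≡⟨ +-comm (d * toℕ q) (toℕ r) ⟩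
    toℕ r + d * toℕ q    ≡⟨ cong (toℕ r +_) (*-comm d (toℕ q)) ⟩
    toℕ r + toℕ q * d    ∎
    where open ≡-Reasoning

  module _ .{{_ : NonZero d}} where

    toℕ-index-quot : (q : Fin n) (r : Fin d) → toℕ (index q r) / d ≡ toℕ q
    toℕ-index-quot q r = begin
      toℕ (index q r) / d           ≡⟨ /-congˡ (toℕ-index q r) ⟩
      (toℕ r + toℕ q * d) / d       ≡⟨ +-distrib-/-∣ʳ (toℕ r) (n∣m*n (toℕ q)) ⟩
      toℕ r / d + toℕ q * d / d     ≡⟨ cong₂ _+_ (m<n⇒m/n≡0 (FinP.toℕ<n r)) (m*n/n≡m (toℕ q) d) ⟩
      toℕ q                         ∎
      where open ≡-Reasoning

    toℕ-index-mod : (q : Fin n) (r : Fin d) → toℕ (index q r) mod d ≡ r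
    toℕ-index-mod q r = FinP.toℕ-injective (begin
      toℕ (toℕ (index q r) mod d)   ≡⟨ FinP.toℕ-fromℕ< _ ⟩
      toℕ (index q r) % d           ≡⟨ cong (_% d) (toℕ-index q r) ⟩
      (toℕ r + toℕ q * d) % d       ≡⟨ [m+kn]%n≡m%n (toℕ r) (toℕ q) d ⟩
      toℕ r % d                     ≡⟨ m<n⇒m%n≡m (FinP.toℕ<n r) ⟩
      toℕ r                         ∎)
      where open ≡-Reasoning

    σ-index : ∀ (t : Tree d) (q : Fin n) r {cs} → childrenOf (toℕ q) t ≡ just cs →
              σ d t (toℕ (index q r)) ≡ just (lookup cs r)
    σ-index t q r {cs} children rewrite toℕ-index-quot q r | children | toℕ-index-mod q r = refl

-- The tree T(π)

module TreeOf (d n : ℕ) .{{_ : NonZero d}} .{{_ : NonZero n}} (π : Permutation′ (d * n)) where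
  open TMap d n π
  open Indexing d n

  N : ℕ
  N = d * n

  0<d : 0 < d
  0<d = >-nonZero⁻¹ d

  parent : Fin N → Fin n
  parent j = proj₁ (split (π ⟨$⟩ʳ j))

  branch : Fin N → Fin d
  branch j = proj₂ (split (π ⟨$⟩ʳ j))

  πinv-split : ∀ j → πinv (parent j) (branch j) ≡ toℕ j
  πinv-split j = cong toℕ (trans (cong (π ⟨$⟩ˡ_) (index-split (π ⟨$⟩ʳ j))) (inverseˡ π))

  πinv-injective : ∀ {q r q′ r′} → πinv q r ≡ πinv q′ r′ → q ≡ q′ × r ≡ r′
  πinv-injective eq = index-injective (trans (sym (inverseʳ π)) (trans (cong (π ⟨$⟩ʳ_) (FinP.toℕ-injective eq)) (inverseʳ π)))

  πinv<N : ∀ q r → πinv q r < N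
  πinv<N q r = FinP.toℕ<n (π ⟨$⟩ˡ index q r)

  private
    maxVec≡maxOf : ∀ {m} (xs : Vec ℕ m) → maxVec xs ≡ maxOf (λ x → x) xs
    maxVec≡maxOf []       = refl
    maxVec≡maxOf (x ∷ xs) = cong (x ⊔_) (maxVec≡maxOf xs)

    ι-max : ∀ q → ι q ≡ suc (maxOf (λ x → x) (tabulate (πinv q)))
    ι-max q = cong suc (maxVec≡maxOf (tabulate (πinv q)))

  πinv<ι : ∀ q r → πinv q r < ι q
  πinv<ι q r = subst (πinv q r <_) (sym (ι-max q))
    (s≤s (subst (_≤ _) (VecP.lookup∘tabulate (πinv q) r) (maxOf-lookup (λ x → x) (tabulate (πinv q)) r)))

  ι-least : ∀ q {b} → (∀ r → πinv q r ≤ b) → ι q ≤ suc b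
  ι-least q {b} bound = subst (_≤ suc b) (sym (ι-max q))
    (s≤s (maxOf-least (λ x → x) (tabulate (πinv q)) λ r → subst (_≤ b) (sym (VecP.lookup∘tabulate (πinv q) r)) (bound r)))

  ι-attained : ∀ q → ∃ λ r → suc (πinv q r) ≡ ι q
  ι-attained q with maxOf-attained (λ x → x) (tabulate (πinv q)) 0<d
  ... | r , attained = r , trans (cong suc (trans (sym (VecP.lookup∘tabulate (πinv q) r)) attained)) (sym (ι-max q))

  ι≤N : ∀ q → ι q ≤ N
  ι≤N q with ι-attained q
  ... | r , attained = subst (_≤ N) attained (πinv<N q r)

  ι-injective : ∀ {q q′} → ι q ≡ ι q′ → q ≡ q′
  ι-injective {q} {q′} eq with ι-attained q | ι-attained q′
  ... | r , e | r′ , e′ = proj₁ (πinv-injective (suc-injective (trans e (trans eq (sym e′)))))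

  IsNode : ℕ → Set
  IsNode i = ∃ λ q → ι q ≡ i

  private
    findQ-just : ∀ {i q} qs → findQ i qs ≡ just q → ι q ≡ i
    findQ-just {i} (q′ ∷ qs) found with ι q′ ≟ i
    findQ-just {i} (q′ ∷ qs) refl  | yes ι≡i = ι≡i
    ...                             | no _    = findQ-just qs found

    findQ-nothing : ∀ {i} qs → findQ i qs ≡ nothing → ∀ {q} → q ∈ qs → ι q ≢ i
    findQ-nothing {i} (q′ ∷ qs) none with ι q′ ≟ i
    findQ-nothing {i} (q′ ∷ qs) ()   | yes _
    findQ-nothing {i} (q′ ∷ qs) none | no ι≢i = λ { (here refl) → ι≢i ; (there q∈) → findQ-nothing qs none q∈ }

  node? : ∀ i → Dec (IsNode i)
  node? i with findQ i (allFin n) in found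
  ... | just q  = yes (q , findQ-just (allFin n) found)
  ... | nothing = no λ (q , ι≡i) → findQ-nothing (allFin n) found (∈-allFin q) ι≡i

  private
    nth-++ : ∀ (xs ys : List (Tree d)) j → j < length xs → nth (xs ++ ys) j ≡ nth xs j
    nth-++ (x ∷ xs) ys zero    _         = refl
    nth-++ (x ∷ xs) ys (suc j) (s≤s j<) = nth-++ xs ys j j<

    nth-last : ∀ (xs : List (Tree d)) y → nth (xs ++ [ y ]) (length xs) ≡ y
    nth-last []       y = refl
    nth-last (x ∷ xs) y = nth-last xs y

    length-taus : ∀ i → length (taus i) ≡ i
    length-taus zero    = refl
    length-taus (suc i) = trans (length-++ (taus i)) (trans (+-comm _ 1) (cong suc (length-taus i)))

  nth-taus : ∀ i j → j < i → nth (taus i) j ≡ τ j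
  nth-taus (suc i) j (s≤s j≤i) with m≤n⇒m<n∨m≡n j≤i
  ... | inj₁ j<i  = trans (nth-++ (taus i) _ j (subst (j <_) (sym (length-taus i)) j<i)) (nth-taus i j j<i)
  ... | inj₂ refl = subst (λ k → nth (taus j ++ [ τ j ]) k ≡ τ j) (length-taus j) (nth-last (taus j) (τ j))

  children : Fin n → Vec (Tree d) d
  children q = tabulate (τ ∘ πinv q)

  lookup-children : ∀ q r → lookup (children q) r ≡ τ (πinv q r)
  lookup-children q r = VecP.lookup∘tabulate (τ ∘ πinv q) r

  τ-node : ∀ {i q} → ι q ≡ i → τ i ≡ node (toℕ q) (children q)
  τ-node {i} {q} ι≡i with findQ i (allFin n) in found
  ... | just q′ with ι-injective (trans (findQ-just (allFin n) found) (sym ι≡i))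
  ...   | refl = cong (node (toℕ q)) (VecP.tabulate-cong λ r → nth-taus i (πinv q r) (subst (πinv q r <_) ι≡i (πinv<ι q r)))
  τ-node {i} {q} ι≡i | nothing = ⊥-elim (findQ-nothing (allFin n) found (∈-allFin q) ι≡i)

  leafLabel : ℕ → ℕ
  leafLabel i = n + i ∸ countBelow i

  τ-leaf : ∀ {i} → ¬ IsNode i → τ i ≡ leaf (leafLabel i)
  τ-leaf {i} ¬isNode with findQ i (allFin n) in found
  ... | just q  = ⊥-elim (¬isNode (q , findQ-just (allFin n) found))
  ... | nothing = refl

  countBelow-zero : countBelow 0 ≡ 0
  countBelow-zero = cong length (filter-none (λ q → ι q <? 0) {allFin n} (All.tabulate λ _ ()))

  countBelow-all : countBelow (suc N) ≡ n
  countBelow-all = trans (cong length (filter-all (λ q → ι q <? suc N) {allFin n} (All.tabulate λ {q} _ → s≤s (ι≤N q))))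
                         (length-tabulate (λ q → q))

  countBelow-suc : ∀ i → countBelow (suc i) ≡ length (filter (λ q → ι q ≟ i) (allFin n)) + countBelow i
  countBelow-suc i = length-filter-⊎ (λ q → ι q <? suc i) (λ q → ι q ≟ i) (λ q → ι q <? i)
    (λ ι<1+i → [ inj₂ , inj₁ ]′ (m≤n⇒m<n∨m≡n (s≤s⁻¹ ι<1+i))) [ s≤s ∘ ≤-reflexive , m<n⇒m<1+n ]′ <-irrefl
    (allFin n)

  countBelow-suc-node : ∀ {i} → IsNode i → countBelow (suc i) ≡ suc (countBelow i)
  countBelow-suc-node {i} (q , ι≡i) = trans (countBelow-suc i) (cong (_+ countBelow i)
    (length-filter-singleton (λ q → ι q ≟ i) (allFin⁺ n) (∈-allFin q) ι≡i
      (λ ι≡i′ → ι-injective (trans ι≡i′ (sym ι≡i)))))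

  countBelow-suc-leaf : ∀ {i} → ¬ IsNode i → countBelow (suc i) ≡ countBelow i
  countBelow-suc-leaf {i} ¬isNode = trans (countBelow-suc i)
    (cong (λ qs → length qs + countBelow i)
      (filter-none (λ q → ι q ≟ i) {allFin n} (All.tabulate λ {q} _ ι≡i → ¬isNode (q , ι≡i))))

  countBelow≤ : ∀ i → countBelow i ≤ i
  countBelow≤ zero    = ≤-reflexive countBelow-zero
  countBelow≤ (suc i) with node? i
  ... | yes isNode = subst (_≤ suc i) (sym (countBelow-suc-node isNode)) (s≤s (countBelow≤ i))
  ... | no ¬isNode = subst (_≤ suc i) (sym (countBelow-suc-leaf ¬isNode)) (m≤n⇒m≤1+n (countBelow≤ i))

  leafLabel-suc-node : ∀ {i} → IsNode i → leafLabel (suc i) ≡ leafLabel i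
  leafLabel-suc-node {i} isNode = cong₂ _∸_ (+-suc n i) (countBelow-suc-node isNode)

  leafLabel-suc-leaf : ∀ {i} → ¬ IsNode i → leafLabel (suc i) ≡ suc (leafLabel i)
  leafLabel-suc-leaf {i} ¬isNode = trans (cong₂ _∸_ (+-suc n i) (countBelow-suc-leaf ¬isNode))
                                       (+-∸-assoc 1 (≤-trans (countBelow≤ i) (m≤n+m i n)))

  leafLabel-zero : leafLabel 0 ≡ n
  leafLabel-zero = trans (cong (n + 0 ∸_) countBelow-zero) (+-identityʳ n)

  leafLabel-all : leafLabel (suc N) ≡ suc N
  leafLabel-all = trans (cong (n + suc N ∸_) countBelow-all) (m+n∸m≡n n (suc N))

  leafLabel-suc-≤ : ∀ i → leafLabel i ≤ leafLabel (suc i) × leafLabel (suc i) ≤ suc (leafLabel i)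
  leafLabel-suc-≤ i with node? i
  ... | yes isNode = ≤-reflexive (sym (leafLabel-suc-node isNode))
                   , ≤-trans (≤-reflexive (leafLabel-suc-node isNode)) (n≤1+n _)
  ... | no ¬isNode = ≤-trans (n≤1+n _) (≤-reflexive (sym (leafLabel-suc-leaf ¬isNode)))
                   , ≤-reflexive (leafLabel-suc-leaf ¬isNode)

  leafLabel-mono : ∀ {i j} → i ≤ j → leafLabel i ≤ leafLabel j
  leafLabel-mono {i} {j} i≤j with m≤n⇒m<n∨m≡n i≤j
  ... | inj₂ refl = ≤-refl
  ... | inj₁ (s≤s i≤j′) = ≤-trans (leafLabel-mono i≤j′) (proj₁ (leafLabel-suc-≤ _))

  n≤leafLabel : ∀ i → n ≤ leafLabel i
  n≤leafLabel i = subst (_≤ leafLabel i) leafLabel-zero (leafLabel-mono z≤n)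

  leafLabel-leaf-< : ∀ {i j} → ¬ IsNode i → i < j → leafLabel i < leafLabel j
  leafLabel-leaf-< {i} {j} ¬isNode i<j = subst (_≤ leafLabel j) (leafLabel-suc-leaf ¬isNode) (leafLabel-mono i<j)

  leafLabel-leaf≤N : ∀ {i} → ¬ IsNode i → i ≤ N → leafLabel i ≤ N
  leafLabel-leaf≤N {i} ¬isNode i≤N =
    s≤s⁻¹ (subst (suc (leafLabel i) ≤_) leafLabel-all (leafLabel-leaf-< ¬isNode (s≤s i≤N)))

  leafLabel-surjective : ∀ {x} → n ≤ x → x ≤ N → ∃ λ j → j ≤ N × ¬ IsNode j × leafLabel j ≡ x
  leafLabel-surjective {x} n≤x x≤N
    with discrete-ivt leafLabel (proj₂ ∘ leafLabel-suc-≤) (suc N)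
           (subst (_≤ x) (sym leafLabel-zero) n≤x) (subst (x <_) (sym leafLabel-all) (s≤s x≤N))
  ... | j , j<1+N , lj≡x , l1+j≡1+x = j , s≤s⁻¹ j<1+N , ¬isNode , lj≡x
    where
    ¬isNode : ¬ IsNode j
    ¬isNode isNode = <-irrefl (trans (sym lj≡x) (trans (sym (leafLabel-suc-node isNode)) l1+j≡1+x)) (n<1+n x)

  -- τ_j is a child of τ_(up j), and m ⇝ i says that this parent map leads from m to i.
  up : Fin N → ℕ
  up j = ι (parent j)

  j<up : ∀ j → toℕ j < up j
  j<up j = subst (_< up j) (πinv-split j) (πinv<ι (parent j) (branch j))

  split-π : ∀ {j q r} → toℕ j ≡ πinv q r → parent j ≡ q × branch j ≡ r
  split-π {j} j≡ = πinv-injective (trans (πinv-split j) j≡)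

  infix 4 _⇝_
  data _⇝_ : ℕ → ℕ → Set where
    here  : ∀ {i} → i ⇝ i
    there : ∀ {m i} (j : Fin N) → toℕ j ≡ m → up j ⇝ i → m ⇝ i

  ⇝-≤ : ∀ {m i} → m ⇝ i → m ≤ i
  ⇝-≤ here              = ≤-refl
  ⇝-≤ (there j refl j⇝) = ≤-trans (<⇒≤ (j<up j)) (⇝-≤ j⇝)

  ⇝-trans : ∀ {a b c} → a ⇝ b → b ⇝ c → a ⇝ c
  ⇝-trans here              b⇝c = b⇝c
  ⇝-trans (there j j≡ a⇝b) b⇝c = there j j≡ (⇝-trans a⇝b b⇝c)

  child-⇝ : ∀ q r → πinv q r ⇝ ι q
  child-⇝ q r = there j refl (subst (λ q′ → ι q′ ⇝ ι q) (sym (proj₁ (split-π {j} refl))) here)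
    where j = π ⟨$⟩ˡ index q r

  ⇝-N : ∀ {m} → m ≤ N → m ⇝ N
  ⇝-N {m} m≤N = go (N ∸ m) m≤N (≤-reflexive (sym (m+[n∸m]≡n m≤N)))
    where
    go : ∀ k {m} → m ≤ N → N ≤ m + k → m ⇝ N
    go k {m} m≤N N≤m+k with m≤n⇒m<n∨m≡n m≤N
    ... | inj₂ refl = here
    go zero    {m} _ N≤m+0   | inj₁ m<N = ⊥-elim (<-irrefl refl (<-≤-trans m<N (subst (N ≤_) (+-identityʳ m) N≤m+0)))
    go (suc k) {m} _ N≤m+1+k | inj₁ m<N = there j toℕj≡m (go k (ι≤N (parent j)) (≤-trans N≤m+1+k m+1+k≤up+k))
      where
      j = fromℕ< m<N
      toℕj≡m : toℕ j ≡ m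
      toℕj≡m = FinP.toℕ-fromℕ< m<N
      m+1+k≤up+k : m + suc k ≤ up j + k
      m+1+k≤up+k = subst (_≤ up j + k) (sym (+-suc m k)) (+-monoˡ-≤ k (subst (_< up j) toℕj≡m (j<up j)))

  ⇝-comparable : ∀ {m a b} → m ⇝ a → m ⇝ b → a ⇝ b ⊎ b ⇝ a
  ⇝-comparable here                  m⇝b   = inj₁ m⇝b
  ⇝-comparable m⇝a@(there _ _ _)     here  = inj₂ m⇝a
  ⇝-comparable (there j j≡ up⇝a) (there j′ j′≡ up⇝b) with FinP.toℕ-injective (trans j≡ (sym j′≡))
  ... | refl = ⇝-comparable up⇝a up⇝b

  ⇝-siblings : ∀ {c c′ q r r′} → c ⇝ c′ → c ≡ πinv q r → c′ ≡ πinv q r′ → r ≡ r′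
  ⇝-siblings here                 c≡ c′≡ = proj₂ (πinv-injective (trans (sym c≡) c′≡))
  ⇝-siblings {q = q} {r′ = r′} (there j j≡ up⇝) c≡ c′≡ with split-π (trans j≡ c≡)
  ... | refl , _ = ⊥-elim (<-irrefl refl (<-≤-trans (πinv<ι q r′) (subst (ι q ≤_) c′≡ (⇝-≤ up⇝))))

  τ-child-⊑ : ∀ q r → τ (πinv q r) ⊑ τ (ι q)
  τ-child-⊑ q r = subst (τ (πinv q r) ⊑_) (sym (τ-node refl))
                    (subst (_⊑ node (toℕ q) (children q)) (lookup-children q r) (child-⊑ r))

  ⇝⇒⊑ : ∀ {m i} → m ⇝ i → τ m ⊑ τ i
  ⇝⇒⊑ here              = here
  ⇝⇒⊑ (there j refl up⇝) =
    ⊑-trans (subst (λ k → τ k ⊑ τ (up j)) (πinv-split j) (τ-child-⊑ (parent j) (branch j))) (⇝⇒⊑ up⇝)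

  ⊑⇒⇝ : ∀ i {w} → w ⊑ τ i → ∃ λ j → j ⇝ i × τ j ≡ w
  ⊑⇒⇝ = <-rec (λ i → ∀ {w} → w ⊑ τ i → ∃ λ j → j ⇝ i × τ j ≡ w) go
    where
    go : ∀ i → (∀ {k} → k < i → ∀ {w} → w ⊑ τ k → ∃ λ j → j ⇝ k × τ j ≡ w) →
         ∀ {w} → w ⊑ τ i → ∃ λ j → j ⇝ i × τ j ≡ w
    go i rec {w} w⊑ with node? i
    ... | no ¬isNode = leaf-case (subst (w ⊑_) (τ-leaf ¬isNode) w⊑)
      where
      leaf-case : w ⊑ leaf (leafLabel i) → ∃ λ j → j ⇝ i × τ j ≡ w
      leaf-case here = i , here , τ-leaf ¬isNode
    ... | yes (q , ι≡i) = node-case (subst (w ⊑_) (τ-node ι≡i) w⊑)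
      where
      node-case : w ⊑ node (toℕ q) (children q) → ∃ λ j → j ⇝ i × τ j ≡ w
      node-case here = i , here , τ-node ι≡i
      node-case (there r w⊑′) with rec (subst (πinv q r <_) ι≡i (πinv<ι q r)) (subst (w ⊑_) (lookup-children q r) w⊑′)
      ... | j , j⇝ , τj≡w = j , ⇝-trans j⇝ (subst (πinv q r ⇝_) ι≡i (child-⇝ q r)) , τj≡w

  label-τ-node : ∀ {i q} → ι q ≡ i → label (τ i) ≡ toℕ q
  label-τ-node ι≡i = cong label (τ-node ι≡i)

  label-τ-leaf : ∀ {i} → ¬ IsNode i → label (τ i) ≡ leafLabel i
  label-τ-leaf ¬isNode = cong label (τ-leaf ¬isNode)

  label-τ-node<leaf : ∀ {i j q} → ι q ≡ i → ¬ IsNode j → label (τ i) < label (τ j)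
  label-τ-node<leaf {j = j} {q} ι≡i ¬isNode = subst₂ _<_ (sym (label-τ-node ι≡i)) (sym (label-τ-leaf ¬isNode))
                                                      (<-≤-trans (FinP.toℕ<n q) (n≤leafLabel j))

  label-τ-leaf-< : ∀ {i j} → ¬ IsNode i → ¬ IsNode j → i < j → label (τ i) < label (τ j)
  label-τ-leaf-< ¬isNode ¬isNode′ i<j = subst₂ _<_ (sym (label-τ-leaf ¬isNode)) (sym (label-τ-leaf ¬isNode′))
                                                (leafLabel-leaf-< ¬isNode i<j)

  label-τ-injective : ∀ {i j} → label (τ i) ≡ label (τ j) → i ≡ j
  label-τ-injective {i} {j} eq with node? i | node? j
  ... | yes (q , ι≡i) | yes (q′ , ι≡j) = trans (sym ι≡i) (trans (cong ι q≡q′) ι≡j)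
    where
    q≡q′ : q ≡ q′
    q≡q′ = FinP.toℕ-injective (trans (sym (label-τ-node ι≡i)) (trans eq (label-τ-node ι≡j)))
  ... | yes (_ , ι≡i) | no ¬isNode  = ⊥-elim (<-irrefl eq (label-τ-node<leaf ι≡i ¬isNode))
  ... | no ¬isNode    | yes (_ , ι≡j) = ⊥-elim (<-irrefl (sym eq) (label-τ-node<leaf ι≡j ¬isNode))
  ... | no ¬isNode    | no ¬isNode′ with <-cmp i j
  ...   | tri< i<j _ _ = ⊥-elim (<-irrefl eq (label-τ-leaf-< ¬isNode ¬isNode′ i<j))
  ...   | tri≈ _ i≡j _ = i≡j
  ...   | tri> _ _ j<i = ⊥-elim (<-irrefl (sym eq) (label-τ-leaf-< ¬isNode′ ¬isNode j<i))

  ∈-labels-τ : ∀ {i x} → x ∈ labels (τ i) → ∃ λ j → j ⇝ i × label (τ j) ≡ x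
  ∈-labels-τ {i} x∈ with ∈-labels⁻ (τ i) x∈
  ... | w , w⊑ , label≡x with ⊑⇒⇝ i w⊑
  ...   | j , j⇝ , refl = j , j⇝ , label≡x

  τ-distinct : ∀ i → DistinctLabels (τ i)
  τ-distinct = <-rec (DistinctLabels ∘ τ) go
    where
    go : ∀ i → (∀ {k} → k < i → DistinctLabels (τ k)) → DistinctLabels (τ i)
    go i rec with node? i
    ... | no ¬isNode = subst DistinctLabels (sym (τ-leaf ¬isNode)) (distinct ([] ∷ []))
    ... | yes (q , ι≡i) = subst DistinctLabels (sym (τ-node ι≡i)) (node-distinct q∉ dls disjoint)
      where
      child<i : ∀ r → πinv q r < i
      child<i r = subst (πinv q r <_) ι≡i (πinv<ι q r)
      ∈-child : ∀ r {x} → x ∈ labels (lookup (children q) r) → ∃ λ j → j ⇝ πinv q r × label (τ j) ≡ x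
      ∈-child r x∈ = ∈-labels-τ (subst (λ u → _ ∈ labels u) (lookup-children q r) x∈)
      q∉ : ∀ r → toℕ q ∉ labels (lookup (children q) r)
      q∉ r q∈ with ∈-child r q∈
      ... | j , j⇝ , labelj≡q with label-τ-injective {j} {i} (trans labelj≡q (sym (label-τ-node ι≡i)))
      ...   | refl = <-irrefl refl (≤-<-trans (⇝-≤ j⇝) (child<i r))
      dls : ∀ r → DistinctLabels (lookup (children q) r)
      dls r = subst DistinctLabels (sym (lookup-children q r)) (rec (child<i r))
      disjoint : ∀ r r′ {x} → x ∈ labels (lookup (children q) r) → x ∈ labels (lookup (children q) r′) → r ≡ r′
      disjoint r r′ x∈ x∈′ with ∈-child r x∈ | ∈-child r′ x∈′
      ... | j , j⇝ , lj | j′ , j′⇝ , lj′ with label-τ-injective {j} {j′} (trans lj (sym lj′))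
      ...   | refl with ⇝-comparable j⇝ j′⇝
      ...     | inj₁ c⇝c′ = ⇝-siblings c⇝c′ refl refl
      ...     | inj₂ c′⇝c = sym (⇝-siblings c′⇝c refl refl)

  τ-⊑-T : ∀ {j} → j ≤ N → τ j ⊑ T d n π
  τ-⊑-T = ⇝⇒⊑ ∘ ⇝-N

  ⊑-T⇒τ : ∀ {w} → w ⊑ T d n π → ∃ λ j → j ≤ N × τ j ≡ w
  ⊑-T⇒τ w⊑ with ⊑⇒⇝ N w⊑
  ... | j , j⇝N , τj≡w = j , ⇝-≤ j⇝N , τj≡w

  ∈-nodeLabels-T⁺ : ∀ {x} → x < n → x ∈ nodeLabels (T d n π)
  ∈-nodeLabels-T⁺ x<n = subst (_∈ nodeLabels (T d n π)) (FinP.toℕ-fromℕ< x<n)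
    (∈-nodeLabels⁺ (subst (_⊑ T d n π) (τ-node refl) (τ-⊑-T (ι≤N (fromℕ< x<n)))))

  ∈-nodeLabels-T⁻ : ∀ {x} → x ∈ nodeLabels (T d n π) → x < n
  ∈-nodeLabels-T⁻ x∈ with ⊑-T⇒τ (proj₂ (∈-nodeLabels⁻ (T d n π) x∈))
  ... | j , _ , τj≡node with node? j
  ...   | yes (q , ι≡j) = subst (_< n) (trans (sym (label-τ-node ι≡j)) (cong label τj≡node)) (FinP.toℕ<n q)
  ...   | no ¬isNode with () ← trans (sym (τ-leaf ¬isNode)) τj≡node

  ∈-leafLabels-T⁺ : ∀ {x} → n ≤ x → x ≤ N → x ∈ leafLabels (T d n π)
  ∈-leafLabels-T⁺ n≤x x≤N with leafLabel-surjective n≤x x≤N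
  ... | j , j≤N , ¬isNode , refl = ∈-leafLabels⁺ (subst (_⊑ T d n π) (τ-leaf ¬isNode) (τ-⊑-T j≤N))

  ∈-leafLabels-T⁻ : ∀ {x} → x ∈ leafLabels (T d n π) → n ≤ x × x ≤ N
  ∈-leafLabels-T⁻ x∈ with ⊑-T⇒τ (∈-leafLabels⁻ (T d n π) x∈)
  ... | j , j≤N , τj≡leaf with node? j
  ...   | yes (q , ι≡j) with () ← trans (sym (τ-node ι≡j)) τj≡leaf
  ...   | no ¬isNode with refl ← trans (sym (τ-leaf ¬isNode)) τj≡leaf = n≤leafLabel j , leafLabel-leaf≤N ¬isNode j≤N

  T-valid : InT d n (T d n π)
  T-valid = unique∧set⇒↭ (distinct⇒nodeLabels-unique _ (τ-distinct N)) (upTo⁺ n)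
                         (∈-upTo⁺ ∘ ∈-nodeLabels-T⁻) (∈-nodeLabels-T⁺ ∘ ∈-upTo⁻)
          , unique∧set⇒↭ (distinct⇒leafLabels-unique _ (τ-distinct N)) (interval-unique n (suc N))
                         (λ x∈ → ∈-interval⁺ (proj₁ (∈-leafLabels-T⁻ x∈)) (s≤s (proj₂ (∈-leafLabels-T⁻ x∈))))
                         (λ x∈ → ∈-leafLabels-T⁺ (proj₁ (∈-interval⁻ x∈)) (s≤s⁻¹ (proj₂ (∈-interval⁻ x∈))))

  children-T : ∀ q → childrenOf (toℕ q) (T d n π) ≡ just (children q)
  children-T q = childrenOf-⊑ (τ-distinct N) (subst (_⊑ T d n π) (τ-node refl) (τ-⊑-T (ι≤N q)))

  σ-T : ∀ i → σ d (T d n π) (toℕ (π ⟨$⟩ʳ i)) ≡ just (τ (toℕ i))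
  σ-T i = begin
    σ d (T d n π) (toℕ (π ⟨$⟩ʳ i))        ≡⟨ cong (σ d (T d n π) ∘ toℕ) (sym (index-split (π ⟨$⟩ʳ i))) ⟩
    σ d (T d n π) (toℕ (index q r))       ≡⟨ σ-index (T d n π) q r (children-T q) ⟩
    just (lookup (children q) r)          ≡⟨ cong just (lookup-children q r) ⟩
    just (τ (πinv q r))                   ≡⟨ cong (just ∘ τ) (πinv-split i) ⟩
    just (τ (toℕ i))                      ∎
    where
    open ≡-Reasoning
    q = parent i
    r = branch i

  maxleaf-τ : ∀ j → suc (maxleaf (τ j)) ≡ leafLabel (suc j)
  maxleaf-τ = <-rec (λ j → suc (maxleaf (τ j)) ≡ leafLabel (suc j)) go
    where
    go : ∀ j → (∀ {k} → k < j → suc (maxleaf (τ k)) ≡ leafLabel (suc k)) → suc (maxleaf (τ j)) ≡ leafLabel (suc j)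
    go j rec with node? j
    ... | no ¬isNode = trans (cong (suc ∘ maxleaf) (τ-leaf ¬isNode)) (sym (leafLabel-suc-leaf ¬isNode))
    ... | yes (q , ι≡j) with ι-attained q
    ...   | r₀ , attained with trans attained ι≡j
    ...     | refl = begin
      suc (maxleaf (τ j))                   ≡⟨ cong (suc ∘ maxleaf) (τ-node ι≡j) ⟩
      suc (maxleafs (children q))           ≡⟨ cong suc maxleafs≡last ⟩
      suc (maxleaf (τ m))                   ≡⟨ rec (n<1+n m) ⟩
      leafLabel j                           ≡⟨ sym (leafLabel-suc-node (q , ι≡j)) ⟩
      leafLabel (suc j)                     ∎
      where
      open ≡-Reasoning
      m = πinv q r₀
      child≤last : ∀ r → maxleaf (lookup (children q) r) ≤ maxleaf (τ m)
      child≤last r = s≤s⁻¹ (subst₂ _≤_ (sym (trans (cong (suc ∘ maxleaf) (lookup-children q r)) (rec child<j)))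
                                        (sym (rec (n<1+n m))) (leafLabel-mono child<j))
        where
        child<j : πinv q r < suc m
        child<j = subst (πinv q r <_) ι≡j (πinv<ι q r)
      maxleafs≡last : maxleafs (children q) ≡ maxleaf (τ m)
      maxleafs≡last = ≤-antisym
        (subst (_≤ maxleaf (τ m)) (sym (maxleafs≡maxOf (children q))) (maxOf-least maxleaf (children q) child≤last))
        (subst (_≤ maxleafs (children q)) (cong maxleaf (lookup-children q r₀)) (maxleaf-lookup (children q) r₀))

  τ-≺-suc : ∀ j → τ j ≺ τ (suc j)
  τ-≺-suc j with node? (suc j)
  ... | no ¬isNode = inj₁ (subst (maxleaf (τ j) <_) (cong maxleaf (sym (τ-leaf ¬isNode))) (≤-reflexive (maxleaf-τ j)))
  ... | yes (q , ι≡1+j) with ι-attained q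
  ...   | r₀ , attained = subst (τ j ≺_) (sym (τ-node ι≡1+j)) (⊑-child-≺ {q = toℕ q} (children q) r₀ τj⊑)
    where
    τj⊑ : τ j ⊑ lookup (children q) r₀
    τj⊑ = subst (τ j ⊑_) (sym (trans (lookup-children q r₀) (cong τ (suc-injective (trans attained ι≡1+j))))) here

  P∘T : IsP d n (T d n π) π
  P∘T i j j≡1+i =
    τ (toℕ i) , τ (toℕ j) , σ-T i , σ-T j , subst (λ k → τ (toℕ i) ≺ τ k) (sym j≡1+i) (τ-≺-suc (toℕ i))

-- The subtrees of a tree in 𝒯

module SubtreesOf (d n : ℕ) .{{_ : NonZero d}} .{{_ : NonZero n}} (t : Tree d) (valid : InT d n t) where
  open Indexing d n

  N : ℕ
  N = d * n

  0<d : 0 < d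
  0<d = >-nonZero⁻¹ d

  ∈-nodeLabels-t⁻ : ∀ {x} → x ∈ nodeLabels t → x < n
  ∈-nodeLabels-t⁻ = ∈-upTo⁻ ∘ ∈-resp-↭ (proj₁ valid)

  ∈-nodeLabels-t⁺ : ∀ {x} → x < n → x ∈ nodeLabels t
  ∈-nodeLabels-t⁺ = ∈-resp-↭ (↭-sym (proj₁ valid)) ∘ ∈-upTo⁺

  ∈-leafLabels-t⁻ : ∀ {x} → x ∈ leafLabels t → n ≤ x × x < suc N
  ∈-leafLabels-t⁻ = ∈-interval⁻ ∘ ∈-resp-↭ (proj₂ valid)

  ∈-leafLabels-t⁺ : ∀ {x} → n ≤ x → x < suc N → x ∈ leafLabels t
  ∈-leafLabels-t⁺ n≤x x<1+N = ∈-resp-↭ (↭-sym (proj₂ valid)) (∈-interval⁺ n≤x x<1+N)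

  t-distinct : DistinctLabels t
  t-distinct = unique⇒distinct t (Unique-resp-↭ (↭-sym (proj₁ valid)) (upTo⁺ n))
                                 (Unique-resp-↭ (↭-sym (proj₂ valid)) (interval-unique n (suc N)))
                                 (λ (x∈n , x∈l) → <⇒≱ (∈-nodeLabels-t⁻ x∈n) (proj₁ (∈-leafLabels-t⁻ x∈l)))

  children-t : Fin n → Vec (Tree d) d
  children-t q = proj₁ (∈-nodeLabels⁻ t (∈-nodeLabels-t⁺ (FinP.toℕ<n q)))

  children-t-⊑ : ∀ q → node (toℕ q) (children-t q) ⊑ t
  children-t-⊑ q = proj₂ (∈-nodeLabels⁻ t (∈-nodeLabels-t⁺ (FinP.toℕ<n q)))

  childrenOf-t : ∀ q → childrenOf (toℕ q) t ≡ just (children-t q)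
  childrenOf-t q = childrenOf-⊑ t-distinct (children-t-⊑ q)

  node-⊑-t : ∀ {a cs} → node a cs ⊑ t → ∃ λ q → toℕ q ≡ a × cs ≡ children-t q
  node-⊑-t {a} a⊑ = q , toℕq≡a , just-injective (trans (sym (childrenOf-⊑ t-distinct a⊑))
                                   (subst (λ b → childrenOf b t ≡ just (children-t q)) toℕq≡a (childrenOf-t q)))
    where
    q = fromℕ< (∈-nodeLabels-t⁻ (∈-nodeLabels⁺ a⊑))
    toℕq≡a : toℕ q ≡ a
    toℕq≡a = FinP.toℕ-fromℕ< _

  sub : Fin N → Tree d
  sub k = lookup (children-t (proj₁ (split k))) (proj₂ (split k))

  sub-index : ∀ q r → sub (index q r) ≡ lookup (children-t q) r
  sub-index q r = cong (λ (q , r) → lookup (children-t q) r) (split-index q r)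

  σ-t : ∀ k → σ d t (toℕ k) ≡ just (sub k)
  σ-t k = subst (λ k → σ d t (toℕ k) ≡ just (sub k)) (index-split k)
            (trans (σ-index t q r (childrenOf-t q)) (cong just (sym (sub-index q r))))
    where
    q = proj₁ (split k)
    r = proj₂ (split k)

  sub-⊑ : ∀ k → sub k ⊑ t
  sub-⊑ k = ⊑-trans (child-⊑ {q = toℕ (proj₁ (split k))} (proj₂ (split k))) (children-t-⊑ (proj₁ (split k)))

  sub-≺ : ∀ k → sub k ≺ t
  sub-≺ k = ≺-⊑-trans (⊑-child-≺ {q = toℕ q} (children-t q) (proj₂ (split k)) here) (children-t-⊑ q)
    where q = proj₁ (split k)

  sub-injective : ∀ {k l} → sub k ≡ sub l → k ≡ l
  sub-injective {k} {l} eq with unique-parent t-distinct (children-t-⊑ (proj₁ (split k))) (children-t-⊑ (proj₁ (split l))) eq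
  ... | q≡q′ , r≡r′ = split-injective (cong₂ _,_ (FinP.toℕ-injective q≡q′) r≡r′)

  sub-comparable : ∀ k l → ¬ sub k ≺ sub l → ¬ sub l ≺ sub k → k ≡ l
  sub-comparable k l k⊀l l⊀k = sub-injective (incomparable⇒≡ t-distinct 0<d (sub-⊑ k) (sub-⊑ l) k⊀l l⊀k)

  IsP⇔linked : ∀ π → IsP d n t π ⇔ Linked _≺_ (sub ∘ (π ⟨$⟩ʳ_))
  IsP⇔linked π = mk⇔ to from
    where
    to : IsP d n t π → Linked _≺_ (sub ∘ (π ⟨$⟩ʳ_))
    to isP i j j≡1+i with isP i j j≡1+i
    ... | u , v , σu , σv , u≺v =
      subst₂ _≺_ (just-injective (trans (sym σu) (σ-t _))) (just-injective (trans (sym σv) (σ-t _))) u≺v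
    from : Linked _≺_ (sub ∘ (π ⟨$⟩ʳ_)) → IsP d n t π
    from linked i j j≡1+i = sub (π ⟨$⟩ʳ i) , sub (π ⟨$⟩ʳ j) , σ-t _ , σ-t _ , linked i j j≡1+i

  IsP⇒increasing : ∀ π → IsP d n t π → Increasing _≺_ (sub ∘ (π ⟨$⟩ʳ_))
  IsP⇒increasing π = linked⇒increasing {R = _≺_} ≺-trans ∘ Equivalence.to (IsP⇔linked π)

  P-exists : ∃ λ π → IsP d n t π
  P-exists = π , Equivalence.from (IsP⇔linked π) (λ i j j≡1+i → increasing i j (≤-reflexive (sym j≡1+i)))
    where
    π = sortingPermutation ≺-irrefl ≺-trans _≺?_ sub sub-comparable
    increasing = sorted-increasing ≺-irrefl ≺-trans _≺?_ sub sub-comparable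

  P-unique : ∀ π π′ → IsP d n t π → IsP d n t π′ → ∀ k → π ⟨$⟩ʳ k ≡ π′ ⟨$⟩ʳ k
  P-unique π π′ isP isP′ =
    increasing-permutation-unique {R = _≺_} ≺-irrefl ≺-trans sub π π′ (IsP⇒increasing π isP) (IsP⇒increasing π′ isP′)

  module Inverse (π : Permutation′ N) (isP : IsP d n t π) where
    open TMap d n π using (τ; ι; πinv)
    open TreeOf d n π hiding (N; 0<d)

    -- The subtree of rank i in the ≺-chain σ_{π(0)}(t) ≺ ⋯ ≺ σ_{π(N-1)}(t) ≺ t.
    ranked : ℕ → Tree d
    ranked i with i <? N
    ... | yes i<N = sub (π ⟨$⟩ʳ fromℕ< i<N)
    ... | no _    = t

    ranked-toℕ : ∀ j → ranked (toℕ j) ≡ sub (π ⟨$⟩ʳ j)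
    ranked-toℕ j with toℕ j <? N
    ... | yes j<N = cong (sub ∘ (π ⟨$⟩ʳ_)) (FinP.fromℕ<-toℕ j j<N)
    ... | no j≮N  = ⊥-elim (j≮N (FinP.toℕ<n j))

    ranked-< : ∀ {i} (i<N : i < N) → ranked i ≡ sub (π ⟨$⟩ʳ fromℕ< i<N)
    ranked-< i<N = trans (cong ranked (sym (FinP.toℕ-fromℕ< i<N))) (ranked-toℕ (fromℕ< i<N))

    ranked-N : ranked N ≡ t
    ranked-N with N <? N
    ... | yes N<N = ⊥-elim (<-irrefl refl N<N)
    ... | no _    = refl

    ranked-⊑ : ∀ {i} → i ≤ N → ranked i ⊑ t
    ranked-⊑ i≤N with m≤n⇒m<n∨m≡n i≤N
    ... | inj₁ i<N  = subst (_⊑ t) (sym (ranked-< i<N)) (sub-⊑ _)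
    ... | inj₂ refl = subst (_⊑ t) (sym ranked-N) here

    ranked-increasing : ∀ {i j} → i < j → j ≤ N → ranked i ≺ ranked j
    ranked-increasing {i} {j} i<j j≤N with m≤n⇒m<n∨m≡n j≤N
    ... | inj₁ j<N  = subst₂ _≺_ (sym (ranked-< (<-trans i<j j<N))) (sym (ranked-< j<N))
                        (IsP⇒increasing π isP _ _ (subst₂ _<_ (sym (FinP.toℕ-fromℕ< _)) (sym (FinP.toℕ-fromℕ< _)) i<j))
    ... | inj₂ refl = subst₂ _≺_ (sym (ranked-< i<j)) (sym ranked-N) (sub-≺ _)

    ranked-reflects : ∀ {i j} → i ≤ N → ranked i ≺ ranked j → i < j
    ranked-reflects {i} {j} i≤N ri≺rj with <-cmp i j
    ... | tri< i<j _ _ = i<j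
    ... | tri≈ _ refl _ = ⊥-elim (≺-irrefl refl ri≺rj)
    ... | tri> _ _ j<i = ⊥-elim (≺-asym ri≺rj (ranked-increasing j<i i≤N))

    ranked-πinv : ∀ q r → ranked (πinv q r) ≡ lookup (children-t q) r
    ranked-πinv q r = trans (ranked-toℕ _) (trans (cong sub (inverseʳ π)) (sub-index q r))

    ⊑-t⇒ranked : ∀ {u} → u ⊑ t → ∃ λ j → j ≤ N × ranked j ≡ u
    ⊑-t⇒ranked u⊑ with ⊑-root-or-child u⊑
    ... | inj₁ refl = N , ≤-refl , ranked-N
    ... | inj₂ (a , cs , r , a⊑ , refl) with node-⊑-t a⊑
    ...   | q , _ , refl = πinv q r , <⇒≤ (πinv<N q r) , ranked-πinv q r

    private
      last-child : ∀ {q m} → suc m ≤ N → ranked (suc m) ≡ node (toℕ q) (children-t q) →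
                   (∀ r → πinv q r ≤ m) → ∃ λ r → πinv q r ≡ m
      last-child {q} {m} 1+m≤N ranked≡node child≤m with maxOf-attained maxleaf (children-t q) 0<d
      ... | r₀ , attained with m≤n⇒m<n∨m≡n (child≤m r₀)
      ...   | inj₂ c₀≡m = r₀ , c₀≡m
      ...   | inj₁ c₀<m = ⊥-elim (<⇒≱ (≺∧maxleaf-≡⇒height-< c₀≺m (trans M₀ (sym Mm))) (⊑-height m⊑c₀))
        where
        c₀ = πinv q r₀
        m≤N = ≤-trans (n≤1+n m) 1+m≤N
        M : ℕ
        M = maxleafs (children-t q)
        M₀ : maxleaf (ranked c₀) ≡ M
        M₀ = trans (cong maxleaf (ranked-πinv q r₀)) (trans attained (sym (maxleafs≡maxOf (children-t q))))
        c₀≺m : ranked c₀ ≺ ranked m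
        c₀≺m = ranked-increasing c₀<m m≤N
        m≺1+m : ranked m ≺ ranked (suc m)
        m≺1+m = ranked-increasing (n<1+n m) 1+m≤N
        Mm : maxleaf (ranked m) ≡ M
        Mm = ≤-antisym (subst (maxleaf (ranked m) ≤_) (cong maxleaf ranked≡node) (≺⇒maxleaf-≤ m≺1+m))
                       (subst (_≤ maxleaf (ranked m)) M₀ (≺⇒maxleaf-≤ c₀≺m))
        m⊑c₀ : ranked m ⊑ ranked c₀
        m⊑c₀ = subst (ranked m ⊑_) (sym (ranked-πinv q r₀))
          (⊑-maxleaf-child t-distinct 0<d (subst (_⊑ t) ranked≡node (ranked-⊑ 1+m≤N)) (ranked-⊑ m≤N) Mm
            (subst (height (ranked m) <_) (cong height ranked≡node)
              (≺∧maxleaf-≡⇒height-< m≺1+m (trans Mm (sym (cong maxleaf ranked≡node)))))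
            r₀ (trans attained (sym (maxleafs≡maxOf (children-t q)))))

      ι-node : ∀ {q} i → i ≤ N → ranked i ≡ node (toℕ q) (children-t q) → (∀ r → πinv q r < i) → ι q ≡ i
      ι-node         zero    _     _       child<0   = ⊥-elim (n≮0 (child<0 (fromℕ< 0<d)))
      ι-node {q} (suc m) 1+m≤N ranked≡node child<1+m with last-child 1+m≤N ranked≡node (s≤s⁻¹ ∘ child<1+m)
      ... | r₀ , c₀≡m = ≤-antisym (ι-least q (s≤s⁻¹ ∘ child<1+m)) (subst (_< ι q) c₀≡m (πinv<ι q r₀))

    ranked-node : ∀ {i a cs} → i ≤ N → ranked i ≡ node a cs → ∃ λ q → toℕ q ≡ a × cs ≡ children-t q × ι q ≡ i
    ranked-node {i} i≤N ranked≡node with node-⊑-t (subst (_⊑ t) ranked≡node (ranked-⊑ i≤N))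
    ... | q , refl , refl = q , refl , refl , ι-node i i≤N ranked≡node child<i
      where
      child<i : ∀ r → πinv q r < i
      child<i r = ranked-reflects (<⇒≤ (πinv<N q r))
        (subst₂ _≺_ (sym (ranked-πinv q r)) (sym ranked≡node) (⊑-child-≺ {q = toℕ q} (children-t q) r here))

    ranked-ι : ∀ q → ranked (ι q) ≡ node (toℕ q) (children-t q)
    ranked-ι q with ⊑-t⇒ranked (children-t-⊑ q)
    ... | j , j≤N , ranked≡node with ranked-node j≤N ranked≡node
    ...   | q′ , toℕq′≡q , _ , ι≡j with FinP.toℕ-injective toℕq′≡q
    ...     | refl = trans (cong ranked ι≡j) ranked≡node

    ranked-leaf-label : ∀ {i p x} → i ≤ N → ranked i ≡ leaf p → n ≤ x → x ≤ p →
                        (∀ {j} → j < i → maxleaf (ranked j) < x) → p ≡ x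
    ranked-leaf-label {i} {p} {x} i≤N ranked≡leaf n≤x x≤p below
      with ⊑-t⇒ranked (∈-leafLabels⁻ t (∈-leafLabels-t⁺ n≤x (≤-<-trans x≤p p<1+N)))
      where p<1+N = proj₂ (∈-leafLabels-t⁻ (∈-leafLabels⁺ (subst (_⊑ t) ranked≡leaf (ranked-⊑ i≤N))))
    ... | j , j≤N , ranked≡leaf′ with <-cmp j i
    ...   | tri< j<i _ _  = ⊥-elim (<-irrefl (cong maxleaf ranked≡leaf′) (below j<i))
    ...   | tri≈ _ refl _ = cong maxleaf (trans (sym ranked≡leaf) ranked≡leaf′)
    ...   | tri> _ _ i<j  = ≤-antisym (subst₂ _≤_ (cong maxleaf ranked≡leaf) (cong maxleaf ranked≡leaf′)
                                                 (≺⇒maxleaf-≤ (ranked-increasing i<j j≤N))) x≤p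

    ranked-leaf-range : ∀ {i p} → i ≤ N → ranked i ≡ leaf p → n ≤ p × p < suc N
    ranked-leaf-range i≤N ranked≡leaf = ∈-leafLabels-t⁻ (∈-leafLabels⁺ (subst (_⊑ t) ranked≡leaf (ranked-⊑ i≤N)))

    ranked-leaf : ∀ {i} → i ≤ N → ¬ IsNode i → ∃ λ p → ranked i ≡ leaf p
    ranked-leaf {i} i≤N ¬isNode = by-shape (ranked i) refl
      where
      by-shape : ∀ u → ranked i ≡ u → ∃ λ p → ranked i ≡ leaf p
      by-shape (leaf p)    ranked≡leaf = p , ranked≡leaf
      by-shape (node a cs) ranked≡node with ranked-node i≤N ranked≡node
      ... | q , _ , _ , ι≡i = ⊥-elim (¬isNode (q , ι≡i))

    maxleaf-ranked<leafLabel : ∀ {i} → (∀ {j} → j < i → τ j ≡ ranked j) →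
                               ∀ {j} → j < i → maxleaf (ranked j) < leafLabel i
    maxleaf-ranked<leafLabel {i} agree {j} j<i =
      subst (_≤ leafLabel i) (trans (sym (maxleaf-τ j)) (cong (suc ∘ maxleaf) (agree j<i))) (leafLabel-mono j<i)

    leafLabel≤ : ∀ i {p} → i ≤ N → ranked i ≡ leaf p → (∀ {j} → j < i → τ j ≡ ranked j) → leafLabel i ≤ p
    leafLabel≤ zero    {p} 0≤N   ranked≡leaf _     =
      subst (_≤ p) (sym leafLabel-zero) (proj₁ (ranked-leaf-range 0≤N ranked≡leaf))
    leafLabel≤ (suc m) {p} 1+m≤N ranked≡leaf agree =
      subst (_≤ p) (trans (cong (suc ∘ maxleaf) (sym (agree (n<1+n m)))) (maxleaf-τ m))
            (≺-leaf (subst (ranked m ≺_) ranked≡leaf (ranked-increasing (n<1+n m) 1+m≤N)))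

    τ≡ranked : ∀ i → i ≤ N → τ i ≡ ranked i
    τ≡ranked = <-rec (λ i → i ≤ N → τ i ≡ ranked i) go
      where
      go : ∀ i → (∀ {j} → j < i → j ≤ N → τ j ≡ ranked j) → i ≤ N → τ i ≡ ranked i
      go i rec i≤N with node? i
      ... | yes (q , ι≡i) = begin
        τ i                                             ≡⟨ τ-node ι≡i ⟩
        node (toℕ q) (tabulate (τ ∘ πinv q))            ≡⟨ cong (node (toℕ q)) (VecP.tabulate-cong τ≡child) ⟩
        node (toℕ q) (tabulate (lookup (children-t q))) ≡⟨ cong (node (toℕ q)) (VecP.tabulate∘lookup (children-t q)) ⟩
        node (toℕ q) (children-t q)                     ≡⟨ sym (ranked-ι q) ⟩
        ranked (ι q)                                    ≡⟨ cong ranked ι≡i ⟩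
        ranked i                                        ∎
        where
        open ≡-Reasoning
        τ≡child : ∀ r → τ (πinv q r) ≡ lookup (children-t q) r
        τ≡child r = trans (rec (subst (πinv q r <_) ι≡i (πinv<ι q r)) (<⇒≤ (πinv<N q r))) (ranked-πinv q r)
      ... | no ¬isNode with ranked-leaf i≤N ¬isNode
      ...   | p , ranked≡leaf = begin
        τ i                  ≡⟨ τ-leaf ¬isNode ⟩
        leaf (leafLabel i)   ≡⟨ cong leaf (sym p≡leafLabel) ⟩
        leaf p               ≡⟨ sym ranked≡leaf ⟩
        ranked i             ∎
        where
        open ≡-Reasoning
        agree : ∀ {j} → j < i → τ j ≡ ranked j
        agree j<i = rec j<i (≤-trans (<⇒≤ j<i) i≤N)
        p≡leafLabel : p ≡ leafLabel i
        p≡leafLabel = ranked-leaf-label i≤N ranked≡leaf (n≤leafLabel i) (leafLabel≤ i i≤N ranked≡leaf agree)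
                                        (maxleaf-ranked<leafLabel agree)

    T∘P : T d n π ≡ t
    T∘P = trans (τ≡ranked N ≤-refl) ranked-N

mainTheorem3 : (d n : ℕ) .{{_ : NonZero d}} .{{_ : NonZero n}} →
    -- T is well defined: T(π) ∈ 𝒯
    ((π : Permutation′ (d * n)) → InT d n (T d n π))
    -- P is well defined: for t ∈ 𝒯 the sorting permutation exists …
    × ((t : Tree d) → InT d n t → ∃ λ (π : Permutation′ (d * n)) → IsP d n t π)
    -- … and is unique
    × ((t : Tree d) → InT d n t → (π π′ : Permutation′ (d * n)) →
        IsP d n t π → IsP d n t π′ → (k : Fin (d * n)) → π ⟨$⟩ʳ k ≡ π′ ⟨$⟩ʳ k)
    -- P(T(π)) = π
    × ((π : Permutation′ (d * n)) → IsP d n (T d n π) π)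
    -- T(P(t)) = t
    × ((t : Tree d) → InT d n t → (π : Permutation′ (d * n)) → IsP d n t π → T d n π ≡ t)
mainTheorem3 d n =
    (λ π → TreeOf.T-valid d n π)
  , (λ t valid → SubtreesOf.P-exists d n t valid)
  , (λ t valid → SubtreesOf.P-unique d n t valid)
  , (λ π → TreeOf.P∘T d n π)
  , (λ t valid π isP → SubtreesOf.Inverse.T∘P d n t valid π isP)
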